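{- Let $b_{0,n}$ be the total number of leaves in all labeled plane 1-2 trees on vertex set $[n]$ ($b_{0,0}=0$), let $B_0(z)=\sum_{n\ge0}b_{0,n}\frac{z^n}{n!}$, and let $B(z)=\sum_{n\ge0}b_n\frac{z^n}{n!}$ where $b_n$ is the number of labeled plane 1-2 trees on $[n]$ and $b_0=1$. Then \[B_0(z)=\frac{6z+\sqrt3\sin(\sqrt3 z)+3\cos(\sqrt3 z)-3}{ -3\sqrt3\sin(\sqrt3 z)+3\cos(\sqrt3 z)+6},\] and $B_0$ satisfies $B_0'(z)=2B_0(z)(B(z)-1)+B_0(z)+1$.
   Context: A labeled plane 1-2 tree on vertex set $[n]=\{1,\dots,n\}$ is a rooted tree whose vertices are bijectively labeled by $[n]$, in which every vertex has at most two children, the label of each non-root vertex is less than the label of its parent, and the children of each vertex are linearly ordered (trees differing only in the order of children are distinct). A leaf is a vertex with no children. One has $B(z)=\frac12+\frac{\sqrt3}{2}\tan\left(\frac{\sqrt3}{2}z+\frac{\pi}{6}\right)$. -}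

module Defs where

open import Data.Nat as ℕ using (ℕ; zero; suc; _≤_; _<_; _≤?_; _<?_)
import Data.Nat.Properties as ℕP
open import Data.Nat.Combinatorics using (_C_)
open import Data.Integer as ℤ using (ℤ; +_; -_)
open import Data.List using (List; []; _∷_; _++_; [_]; length; map; concatMap; filter; upTo)
open import Data.Nat.ListAction using (sum)
open import Data.List.Relation.Unary.All using (All; all?)
open import Data.List.Relation.Unary.Unique.Propositional using (Unique)
open import Data.List.Relation.Unary.Unique.DecPropositional ℕP._≟_ using (unique?)
open import Data.Product using (_×_; _,_)
open import Data.Product.Properties using ()
open import Data.Unit using (⊤; tt)
open import Relation.Nullary using (Dec; yes; no; _×-dec_)
open import Relation.Binary.PropositionalEquality using (_≡_)

data PTree : Set where
  leaf   : ℕ → PTree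
  unary  : ℕ → PTree → PTree
  binary : ℕ → PTree → PTree → PTree

rootLabel : PTree → ℕ
rootLabel (leaf ℓ)       = ℓ
rootLabel (unary ℓ _)    = ℓ
rootLabel (binary ℓ _ _) = ℓ

labels : PTree → List ℕ
labels (leaf ℓ)       = ℓ ∷ []
labels (unary ℓ c)    = ℓ ∷ labels c
labels (binary ℓ l r) = ℓ ∷ labels l ++ labels r

size : PTree → ℕ
size t = length (labels t)

leaves : PTree → ℕ
leaves (leaf _)       = 1
leaves (unary _ c)    = leaves c
leaves (binary _ l r) = leaves l ℕ.+ leaves r

Decreasing : PTree → Set
Decreasing (leaf _)       = ⊤
Decreasing (unary ℓ c)    = (rootLabel c < ℓ) × Decreasing c
Decreasing (binary ℓ l r) = (rootLabel l < ℓ) × (rootLabel r < ℓ) × Decreasing l × Decreasing r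

decreasing? : (t : PTree) → Dec (Decreasing t)
decreasing? (leaf _)       = yes tt
decreasing? (unary ℓ c)    = (rootLabel c <? ℓ) ×-dec decreasing? c
decreasing? (binary ℓ l r) =
  (rootLabel l <? ℓ) ×-dec ((rootLabel r <? ℓ) ×-dec (decreasing? l ×-dec decreasing? r))

InRange : ℕ → ℕ → Set
InRange n ℓ = (1 ≤ ℓ) × (ℓ ≤ n)

-- A labeled plane 1-2 tree on vertex set [n]: exactly n vertices, the
-- labels are pairwise distinct elements of {1,…,n} (hence a bijection
-- onto [n]), and labels decrease from parent to child.
IsLabeled12Tree : ℕ → PTree → Set
IsLabeled12Tree n t =
  (size t ≡ n) × All (InRange n) (labels t) × Unique (labels t) × Decreasing t

isLabeled12Tree? : (n : ℕ) (t : PTree) → Dec (IsLabeled12Tree n t)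
isLabeled12Tree? n t =
  (size t ℕP.≟ n) ×-dec
  (all? (λ ℓ → (1 ≤? ℓ) ×-dec (ℓ ≤? n)) (labels t) ×-dec
  (unique? (labels t) ×-dec decreasing? t))

-- Exhaustive, duplicate-free enumeration of all plane 1-2 trees of
-- height < h whose labels lie in {1,…,n}.

labelRange : ℕ → List ℕ
labelRange n = map suc (upTo n)

treesOfHeight< : ℕ → ℕ → List PTree
treesOfHeight< n zero    = []
treesOfHeight< n (suc h) =
  concatMap (λ ℓ →
       [ leaf ℓ ]
    ++ map (unary ℓ) (treesOfHeight< n h)
    ++ concatMap (λ l → map (binary ℓ l) (treesOfHeight< n h)) (treesOfHeight< n h))
    (labelRange n)

-- All labeled plane 1-2 trees on [n] (a tree with n vertices has height < n+1).
labeled12Trees : ℕ → List PTree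
labeled12Trees n = filter (isLabeled12Tree? n) (treesOfHeight< n (suc n))

b : ℕ → ℕ
b zero    = 1
b (suc n) = length (labeled12Trees (suc n))

-- b_{0,n} : total number of leaves over all labeled plane 1-2 trees on [n]
-- (b_{0,0} = 0 automatically: there is no tree with 0 vertices)
b0 : ℕ → ℕ
b0 n = sum (map leaves (labeled12Trees n))

-- Exponential formal power series over ℤ: F(z) = Σ f n · zⁿ / n!,
-- represented by the sequence f of EGF coefficients.

EGF : Set
EGF = ℕ → ℤ

sumTo : ℕ → (ℕ → ℤ) → ℤ
sumTo zero    f = f zero
sumTo (suc n) f = sumTo n f ℤ.+ f (suc n)

_⊛_ : EGF → EGF → EGF
(f ⊛ g) n = sumTo n (λ k → (+ (n C k)) ℤ.* f k ℤ.* g (n ℕ.∸ k))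

_⊕_ : EGF → EGF → EGF
(f ⊕ g) n = f n ℤ.+ g n

scale : ℤ → EGF → EGF
scale c f n = c ℤ.* f n

deriv : EGF → EGF
deriv f n = f (suc n)

one : EGF
one zero    = + 1
one (suc _) = + 0

zS : EGF
zS 1 = + 1
zS _ = + 0

fromℕseq : (ℕ → ℕ) → EGF
fromℕseq a n = + (a n)

-- √3 · sin(√3 z) = Σ_k (-1)^k 3^{k+1} z^{2k+1}/(2k+1)!
sqrt3SinSqrt3 : EGF
sqrt3SinSqrt3 n with n ℕ.% 2
... | zero = + 0
... | _    = (- (+ 1)) ℤ.^ (n ℕ./ 2) ℤ.* (+ (3 ℕ.^ (suc (n ℕ./ 2))))

-- cos(√3 z) = Σ_k (-3)^k z^{2k}/(2k)!
cosSqrt3 : EGF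
cosSqrt3 n with n ℕ.% 2
... | zero = (- (+ 3)) ℤ.^ (n ℕ./ 2)
... | _    = + 0

numer : EGF
numer = scale (+ 6) zS ⊕ (sqrt3SinSqrt3 ⊕ (scale (+ 3) cosSqrt3 ⊕ scale (- (+ 3)) one))

denom : EGF
denom = scale (- (+ 3)) sqrt3SinSqrt3 ⊕ (scale (+ 3) cosSqrt3 ⊕ scale (+ 6) one)

B0S : EGF
B0S = fromℕseq b0

BS : EGF
BS = fromℕseq b

module Submission where

-- Counting side: a tree on a label set is decomposed at its root, which
-- carries the largest label; the remaining labels are either absent, all
-- in one child, or split between two ordered children.  Since the count
-- only depends on the size of the label set, this gives T′ = 1 + T + T²
-- for T = B − 1 and L′ = L·T + T·L + L + 1 for L = B₀, with T(0) = L(0) = 0.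
--
-- Series side: EGFs form a commutative ring (all laws follow from the
-- Leibniz rule).  With S = √3 sin(√3z) and C = cos(√3z) we have S′ = 3C,
-- C′ = −S and S² + 3C² = 3.  Both T·D and R = 3S + 3C − 3 solve the Riccati
-- equation P′D = PD′ + D² + PD + P², whose solutions are determined by P(0)
-- because D(0) = 9 ≠ 0; so T·D = R.  Then (L·D)′ = D = N′, whence L·D = N.

open import Defs

module SeriesAlgebra where

  open import Data.Nat as ℕ using (ℕ; zero; suc; _≤_; _<_; z≤n; s≤s; _∸_)
  import Data.Nat.Properties as ℕP
  open import Data.Nat.Combinatorics using (_C_; nCk+nC[k+1]≡[n+1]C[k+1]; nCn≡1; k>n⇒nCk≡0)
  open import Data.Integer as ℤ using (ℤ; +_; -_; _+_; _*_)
  import Data.Integer.Properties as ℤP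
  open import Data.Integer.Tactic.RingSolver using (solve-∀)
  open import Data.Product using (_,_)
  open import Data.Maybe using (Maybe; just; nothing)
  open import Relation.Nullary using (yes; no)
  open import Relation.Binary.Structures using (IsEquivalence)
  open import Algebra.Structures using (IsCommutativeRing)
  open import Algebra.Bundles using (CommutativeRing)
  import Algebra.Solver.Ring.AlmostCommutativeRing as ACR
  open import Relation.Binary.PropositionalEquality
  open ≡-Reasoning

  infix 4 _≐_
  _≐_ : EGF → EGF → Set
  f ≐ g = ∀ n → f n ≡ g n

  sumTo-cong : ∀ n {f g : ℕ → ℤ} → (∀ k → k ≤ n → f k ≡ g k) → sumTo n f ≡ sumTo n g
  sumTo-cong zero    eq = eq 0 z≤n
  sumTo-cong (suc n) eq =
    cong₂ _+_ (sumTo-cong n (λ k k≤n → eq k (ℕP.m≤n⇒m≤1+n k≤n))) (eq (suc n) ℕP.≤-refl)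

  sumTo-+ : ∀ n (f g : ℕ → ℤ) → sumTo n (λ k → f k + g k) ≡ sumTo n f + sumTo n g
  sumTo-+ zero    f g = refl
  sumTo-+ (suc n) f g = begin
    sumTo n (λ k → f k + g k) + (f (suc n) + g (suc n))
      ≡⟨ cong (_+ (f (suc n) + g (suc n))) (sumTo-+ n f g) ⟩
    (sumTo n f + sumTo n g) + (f (suc n) + g (suc n))
      ≡⟨ interchange (sumTo n f) (sumTo n g) (f (suc n)) (g (suc n)) ⟩
    (sumTo n f + f (suc n)) + (sumTo n g + g (suc n)) ∎
    where
    interchange : ∀ a b c d → (a + b) + (c + d) ≡ (a + c) + (b + d)
    interchange = solve-∀

  sumTo-*ˡ : ∀ n c (f : ℕ → ℤ) → sumTo n (λ k → c * f k) ≡ c * sumTo n f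
  sumTo-*ˡ zero    c f = refl
  sumTo-*ˡ (suc n) c f =
    trans (cong (_+ c * f (suc n)) (sumTo-*ˡ n c f)) (sym (ℤP.*-distribˡ-+ c (sumTo n f) (f (suc n))))

  sumTo-front : ∀ n (f : ℕ → ℤ) → sumTo (suc n) f ≡ f 0 + sumTo n (λ k → f (suc k))
  sumTo-front zero    f = refl
  sumTo-front (suc n) f =
    trans (cong (_+ f (suc (suc n))) (sumTo-front n f)) (ℤP.+-assoc (f 0) _ _)

  sumTo-zero : ∀ n (f : ℕ → ℤ) → (∀ k → f k ≡ + 0) → sumTo n f ≡ + 0
  sumTo-zero zero    f z = z 0
  sumTo-zero (suc n) f z = cong₂ _+_ (sumTo-zero n f z) (z (suc n))

  -- The product rule (f·g)' = f'·g + f·g', which on coefficients is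
  -- Pascal's rule C(n+1,k+1) = C(n,k) + C(n,k+1).
  leibniz : ∀ f g n → (f ⊛ g) (suc n) ≡ (deriv f ⊛ g) n + (f ⊛ deriv g) n
  leibniz f g n = begin
    (f ⊛ g) (suc n)
      ≡⟨ sumTo-front n _ ⟩
    h₀ + sumTo n (λ k → + (suc n C suc k) * f (suc k) * g (n ∸ k))
      ≡⟨ cong (λ y → h₀ + y) (trans (sumTo-cong n (λ k _ → pascal k)) (sumTo-+ n A B)) ⟩
    h₀ + (sumTo n A + sumTo n B)
      ≡⟨ rotate h₀ (sumTo n A) (sumTo n B) ⟩
    sumTo n A + (h₀ + sumTo n B)
      ≡⟨ cong (λ y → sumTo n A + y) shifted ⟩
    (deriv f ⊛ g) n + (f ⊛ deriv g) n ∎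
    where
    h₀ = + 1 * f 0 * g (suc n)
    A B H : ℕ → ℤ
    A k = + (n C k) * f (suc k) * g (n ∸ k)
    B k = + (n C suc k) * f (suc k) * g (n ∸ k)
    H k = + (n C k) * f k * g (suc n ∸ k)
    rotate : ∀ a b c → a + (b + c) ≡ b + (a + c)
    rotate = solve-∀
    pascal : ∀ k → + (suc n C suc k) * f (suc k) * g (n ∸ k) ≡ A k + B k
    pascal k = begin
      + (suc n C suc k) * f (suc k) * g (n ∸ k)
        ≡⟨ cong (λ x → + x * f (suc k) * g (n ∸ k)) (sym (nCk+nC[k+1]≡[n+1]C[k+1] n k)) ⟩
      (+ (n C k) + + (n C suc k)) * f (suc k) * g (n ∸ k)
        ≡⟨ distrib (+ (n C k)) (+ (n C suc k)) (f (suc k)) (g (n ∸ k)) ⟩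
      A k + B k ∎
      where
      distrib : ∀ a b x y → (a + b) * x * y ≡ a * x * y + b * x * y
      distrib = solve-∀
    -- the last term of (f ⊛ g') n vanishes because C(n, n+1) = 0
    lastVanishes : H (suc n) ≡ + 0
    lastVanishes rewrite k>n⇒nCk≡0 (ℕP.n<1+n n) = refl
    shifted : h₀ + sumTo n B ≡ (f ⊛ deriv g) n
    shifted = begin
      h₀ + sumTo n B                 ≡⟨ sym (sumTo-front n H) ⟩
      sumTo (suc n) H                ≡⟨ cong (λ y → sumTo n H + y) lastVanishes ⟩
      sumTo n H + + 0                ≡⟨ ℤP.+-identityʳ _ ⟩
      sumTo n H                      ≡⟨ sumTo-cong n (λ k k≤n →
                                          cong (λ x → + (n C k) * f k * g x) (ℕP.+-∸-assoc 1 k≤n)) ⟩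
      (f ⊛ deriv g) n ∎

  ⊛-cong : ∀ {f f′ g g′} → f ≐ f′ → g ≐ g′ → (f ⊛ g) ≐ (f′ ⊛ g′)
  ⊛-cong p q n = sumTo-cong n (λ k _ → cong₂ (λ x y → + (n C k) * x * y) (p k) (q (n ∸ k)))

  ⊕-cong : ∀ {f f′ g g′} → f ≐ f′ → g ≐ g′ → (f ⊕ g) ≐ (f′ ⊕ g′)
  ⊕-cong p q n = cong₂ _+_ (p n) (q n)

  ⊛-distribˡ : ∀ f g h → (f ⊛ (g ⊕ h)) ≐ ((f ⊛ g) ⊕ (f ⊛ h))
  ⊛-distribˡ f g h n =
    trans (sumTo-cong n (λ k _ → ℤP.*-distribˡ-+ (+ (n C k) * f k) (g (n ∸ k)) (h (n ∸ k))))
          (sumTo-+ n _ _)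

  -- Commutativity and associativity follow by induction on the index:
  -- coefficient n+1 reduces to coefficients n of products with derivatives.
  ⊛-comm : ∀ f g → (f ⊛ g) ≐ (g ⊛ f)
  ⊛-comm f g zero = swap₀ (f 0) (g 0)
    where
    swap₀ : ∀ x y → + 1 * x * y ≡ + 1 * y * x
    swap₀ = solve-∀
  ⊛-comm f g (suc n) = begin
    (f ⊛ g) (suc n)                      ≡⟨ leibniz f g n ⟩
    (deriv f ⊛ g) n + (f ⊛ deriv g) n    ≡⟨ cong₂ _+_ (⊛-comm (deriv f) g n) (⊛-comm f (deriv g) n) ⟩
    (g ⊛ deriv f) n + (deriv g ⊛ f) n    ≡⟨ ℤP.+-comm ((g ⊛ deriv f) n) ((deriv g ⊛ f) n) ⟩
    (deriv g ⊛ f) n + (g ⊛ deriv f) n    ≡⟨ sym (leibniz g f n) ⟩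
    (g ⊛ f) (suc n) ∎

  ⊛-distribʳ : ∀ f g h → ((g ⊕ h) ⊛ f) ≐ ((g ⊛ f) ⊕ (h ⊛ f))
  ⊛-distribʳ f g h n =
    trans (⊛-comm (g ⊕ h) f n) (trans (⊛-distribˡ f g h n) (cong₂ _+_ (⊛-comm f g n) (⊛-comm f h n)))

  ⊛-assoc : ∀ f g h → ((f ⊛ g) ⊛ h) ≐ (f ⊛ (g ⊛ h))
  ⊛-assoc f g h zero = assoc₀ (f 0) (g 0) (h 0)
    where
    assoc₀ : ∀ x y z → + 1 * (+ 1 * x * y) * z ≡ + 1 * x * (+ 1 * y * z)
    assoc₀ = solve-∀
  ⊛-assoc f g h (suc n) = begin
    ((f ⊛ g) ⊛ h) (suc n)
      ≡⟨ leibniz (f ⊛ g) h n ⟩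
    (deriv (f ⊛ g) ⊛ h) n + ((f ⊛ g) ⊛ deriv h) n
      ≡⟨ cong (_+ ((f ⊛ g) ⊛ deriv h) n)
              (trans (⊛-cong {g = h} (leibniz f g) (λ _ → refl) n) (⊛-distribʳ h (deriv f ⊛ g) (f ⊛ deriv g) n)) ⟩
    (((deriv f ⊛ g) ⊛ h) n + ((f ⊛ deriv g) ⊛ h) n) + ((f ⊛ g) ⊛ deriv h) n
      ≡⟨ cong₂ _+_ (cong₂ _+_ (⊛-assoc (deriv f) g h n) (⊛-assoc f (deriv g) h n))
                   (⊛-assoc f g (deriv h) n) ⟩
    ((deriv f ⊛ (g ⊛ h)) n + (f ⊛ (deriv g ⊛ h)) n) + (f ⊛ (g ⊛ deriv h)) n
      ≡⟨ ℤP.+-assoc ((deriv f ⊛ (g ⊛ h)) n) ((f ⊛ (deriv g ⊛ h)) n) ((f ⊛ (g ⊛ deriv h)) n) ⟩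
    (deriv f ⊛ (g ⊛ h)) n + ((f ⊛ (deriv g ⊛ h)) n + (f ⊛ (g ⊛ deriv h)) n)
      ≡⟨ cong (λ y → (deriv f ⊛ (g ⊛ h)) n + y)
              (sym (trans (⊛-cong {f = f} (λ _ → refl) (leibniz g h) n) (⊛-distribˡ f (deriv g ⊛ h) (g ⊛ deriv h) n))) ⟩
    (deriv f ⊛ (g ⊛ h)) n + (f ⊛ deriv (g ⊛ h)) n
      ≡⟨ sym (leibniz f (g ⊛ h) n) ⟩
    (f ⊛ (g ⊛ h)) (suc n) ∎

  zeroS : EGF
  zeroS _ = + 0

  ⊛-zeroʳ : ∀ f → (f ⊛ zeroS) ≐ zeroS
  ⊛-zeroʳ f n = sumTo-zero n _ (λ k → ℤP.*-zeroʳ (+ (n C k) * f k))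

  ⊛-identityʳ : ∀ f → (f ⊛ one) ≐ f
  ⊛-identityʳ f zero    = trans (ℤP.*-identityʳ (+ 1 * f 0)) (ℤP.*-identityˡ (f 0))
  ⊛-identityʳ f (suc n) = begin
    (f ⊛ one) (suc n)                       ≡⟨ leibniz f one n ⟩
    (deriv f ⊛ one) n + (f ⊛ deriv one) n   ≡⟨ cong₂ _+_ (⊛-identityʳ (deriv f) n) (⊛-zeroʳ f n) ⟩
    f (suc n) + + 0                         ≡⟨ ℤP.+-identityʳ (f (suc n)) ⟩
    f (suc n) ∎

  ⊛-scaleʳ : ∀ c f g → (f ⊛ scale c g) ≐ scale c (f ⊛ g)
  ⊛-scaleʳ c f g n = trans (sumTo-cong n (λ k _ → pull c (+ (n C k) * f k) (g (n ∸ k)))) (sumTo-*ˡ n c _)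
    where
    pull : ∀ a x y → x * (a * y) ≡ a * (x * y)
    pull = solve-∀

  ⊛-local : ∀ {f f′ g g′} n → (∀ j → j ≤ n → f j ≡ f′ j) → (∀ j → j ≤ n → g j ≡ g′ j) →
            (f ⊛ g) n ≡ (f′ ⊛ g′) n
  ⊛-local n p q = sumTo-cong n (λ k k≤n →
    cong₂ (λ x y → + (n C k) * x * y) (p k k≤n) (q (n ∸ k) (ℕP.m∸n≤m n k)))

  -- The top coefficient f n enters (f ⊛ g) n only through the term f n · g 0:
  -- exchanging it for f′ n changes the coefficient by (f′ n − f n) · g 0.
  ⊛-top : ∀ n f f′ g → (∀ j → j < n → f j ≡ f′ j) →
          (f ⊛ g) n + f′ n * g 0 ≡ (f′ ⊛ g) n + f n * g 0
  ⊛-top zero    f f′ g _     = swap (f 0) (f′ 0) (g 0)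
    where
    swap : ∀ x y z → + 1 * x * z + y * z ≡ + 1 * y * z + x * z
    swap = solve-∀
  ⊛-top (suc m) f f′ g agree = begin
    (sumTo m (term f) + term f (suc m)) + f′ (suc m) * g 0
      ≡⟨ cong₂ (λ x y → (x + y) + f′ (suc m) * g 0) lower (topTerm f) ⟩
    (sumTo m (term f′) + + 1 * f (suc m) * g 0) + f′ (suc m) * g 0
      ≡⟨ exchange (sumTo m (term f′)) (f (suc m)) (f′ (suc m)) (g 0) ⟩
    (sumTo m (term f′) + + 1 * f′ (suc m) * g 0) + f (suc m) * g 0
      ≡⟨ cong (λ y → (sumTo m (term f′) + y) + f (suc m) * g 0) (sym (topTerm f′)) ⟩
    (sumTo m (term f′) + term f′ (suc m)) + f (suc m) * g 0 ∎
    where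
    term : EGF → ℕ → ℤ
    term u k = + (suc m C k) * u k * g (suc m ∸ k)
    lower : sumTo m (term f) ≡ sumTo m (term f′)
    lower = sumTo-cong m (λ k k≤m → cong (λ x → + (suc m C k) * x * g (suc m ∸ k)) (agree k (s≤s k≤m)))
    topTerm : ∀ u → term u (suc m) ≡ + 1 * u (suc m) * g 0
    topTerm u = cong₂ (λ a b → + a * u (suc m) * g b) (nCn≡1 (suc m)) (ℕP.n∸n≡0 m)
    exchange : ∀ a x y z → (a + + 1 * x * z) + y * z ≡ (a + + 1 * y * z) + x * z
    exchange = solve-∀

  negS : EGF → EGF
  negS f n = - f n

  egfIsCommutativeRing : IsCommutativeRing _≐_ _⊕_ _⊛_ negS zeroS one
  egfIsCommutativeRing = record
    { isRing = record
      { +-isAbelianGroup = record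
        { isGroup = record
          { isMonoid = record
            { isSemigroup = record
              { isMagma = record { isEquivalence = ≐-isEquivalence ; ∙-cong = ⊕-cong }
              ; assoc = λ f g h n → ℤP.+-assoc (f n) (g n) (h n) }
            ; identity = (λ f n → ℤP.+-identityˡ (f n)) , (λ f n → ℤP.+-identityʳ (f n)) }
          ; inverse = (λ f n → ℤP.+-inverseˡ (f n)) , (λ f n → ℤP.+-inverseʳ (f n))
          ; ⁻¹-cong = λ p n → cong -_ (p n) }
        ; comm = λ f g n → ℤP.+-comm (f n) (g n) }
      ; *-cong = ⊛-cong
      ; *-assoc = ⊛-assoc
      ; *-identity = (λ f n → trans (⊛-comm one f n) (⊛-identityʳ f n)) , ⊛-identityʳ
      ; distrib = ⊛-distribˡ , ⊛-distribʳ }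
    ; *-comm = ⊛-comm }
    where
    ≐-isEquivalence : IsEquivalence _≐_
    ≐-isEquivalence = record
      { refl = λ _ → refl ; sym = λ p n → sym (p n) ; trans = λ p q n → trans (p n) (q n) }

  egfRing : CommutativeRing _ _
  egfRing = record { isCommutativeRing = egfIsCommutativeRing }

  cst : ℤ → EGF
  cst c = scale c one

  scale≐cst⊛ : ∀ c g → scale c g ≐ (cst c ⊛ g)
  scale≐cst⊛ c g n =
    sym (trans (⊛-comm (cst c) g n) (trans (⊛-scaleʳ c g one n) (cong (c *_) (⊛-identityʳ g n))))

  -- c ↦ c·1 is a ring morphism ℤ → EGF; it lets the solver use integer
  -- coefficients, and cst-equal? is its (sound) test for equal constants.
  cstHomomorphism : ℤ.+-*-rawRing ACR.-Raw-AlmostCommutative⟶ ACR.fromCommutativeRing egfRing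
  cstHomomorphism = record
    { ⟦_⟧    = cst
    ; +-homo = λ a b n → ℤP.*-distribʳ-+ (one n) a b
    ; *-homo = λ a b n → trans (ℤP.*-assoc a b (one n)) (scale≐cst⊛ a (cst b) n)
    ; -‿homo = λ a n → sym (ℤP.neg-distribˡ-* a (one n))
    ; 0-homo = λ n → refl
    ; 1-homo = λ n → ℤP.*-identityˡ (one n) }

  cst-equal? : ∀ a b → Maybe (cst a ≐ cst b)
  cst-equal? a b with a ℤ.≟ b
  ... | yes refl = just (λ _ → refl)
  ... | no _     = nothing

module SeriesIdentities where

  open SeriesAlgebra
  open import Data.Nat as ℕ using (zero; suc; _≤_; z≤n; s≤s)
  import Data.Nat.Properties as ℕP
  open import Data.Nat.DivMod using (_%_; _/_; m/n≡1+[m∸n]/n)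
  open import Data.Integer as ℤ using (+_; -_; _+_; _*_; _^_)
  import Data.Integer.Properties as ℤP
  open import Data.Integer.Tactic.RingSolver using (solve-∀)
  open import Algebra.Bundles using (AbelianGroup; CommutativeRing)
  open import Algebra.Properties.Group (AbelianGroup.group ℤP.+-0-abelianGroup) using (∙-cancelˡ)
  import Algebra.Solver.Ring.AlmostCommutativeRing as ACR
  open import Algebra.Solver.Ring ℤ.+-*-rawRing (ACR.fromCommutativeRing egfRing) cstHomomorphism cst-equal?
    using (Polynomial; solve; _:+_; _:*_; :-_; _:-_; con; _:=_)
  open import Data.Sum using (inj₁; inj₂)
  open import Relation.Binary.PropositionalEquality using (_≡_; _≢_; refl; sym; trans; cong; cong₂)
  open import Relation.Binary.Reasoning.Setoid (CommutativeRing.setoid egfRing)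

  S C : EGF
  S = sqrt3SinSqrt3
  C = cosSqrt3

  halfStep : ∀ n → suc (suc n) / 2 ≡ suc (n / 2)
  halfStep n = m/n≡1+[m∸n]/n {suc (suc n)} {2} (s≤s (s≤s z≤n))

  -- Both series satisfy F'' = −3 F, i.e. a two-step recurrence on coefficients.
  S-step : ∀ n → S (suc (suc n)) ≡ - (+ 3) * S n
  S-step n with n % 2
  ... | zero  = refl
  ... | suc _ rewrite halfStep n =
    trans (cong ((- (+ 1)) ^ suc (n / 2) *_) (ℤP.pos-* 3 (3 ℕ.^ suc (n / 2))))
          (regroup ((- (+ 1)) ^ (n / 2)) (+ (3 ℕ.^ suc (n / 2))))
    where
    regroup : ∀ a b → (- (+ 1)) * a * (+ 3 * b) ≡ - (+ 3) * (a * b)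
    regroup = solve-∀

  C-step : ∀ n → C (suc (suc n)) ≡ - (+ 3) * C n
  C-step n with n % 2
  ... | zero rewrite halfStep n = refl
  ... | suc _ = refl

  -- S' = 3C and C' = −S, checked on the first two coefficients and
  -- propagated by the two-step recurrences.
  S-deriv : ∀ n → S (suc n) ≡ + 3 * C n
  S-deriv zero          = refl
  S-deriv (suc zero)    = refl
  S-deriv (suc (suc n)) =
    trans (S-step (suc n)) (trans (cong (- (+ 3) *_) (S-deriv n))
          (trans (commute (C n)) (cong (+ 3 *_) (sym (C-step n)))))
    where
    commute : ∀ x → - (+ 3) * (+ 3 * x) ≡ + 3 * (- (+ 3) * x)
    commute = solve-∀

  C-deriv : ∀ n → C (suc n) ≡ - S n
  C-deriv zero          = refl
  C-deriv (suc zero)    = refl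
  C-deriv (suc (suc n)) =
    trans (C-step (suc n)) (trans (cong (- (+ 3) *_) (C-deriv n))
          (trans (negate (S n)) (cong -_ (sym (S-step n)))))
    where
    negate : ∀ x → - (+ 3) * (- x) ≡ - (- (+ 3) * x)
    negate = solve-∀

  -- Congruence rules for rewriting inside sums and products.  The fixed
  -- factor of a product is passed explicitly: it cannot be recovered by
  -- unification from a coefficient of the product.
  infixl 6 _⟨⊕⟩_
  _⟨⊕⟩_ : ∀ {f f′ g g′} → f ≐ f′ → g ≐ g′ → (f ⊕ g) ≐ (f′ ⊕ g′)
  _⟨⊕⟩_ = ⊕-cong

  ⊛-congˡ : ∀ {f f′} g → f ≐ f′ → (f ⊛ g) ≐ (f′ ⊛ g)
  ⊛-congˡ g p = ⊛-cong {g = g} p (λ _ → refl)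

  ⊛-congʳ : ∀ f {g g′} → g ≐ g′ → (f ⊛ g) ≐ (f ⊛ g′)
  ⊛-congʳ f q = ⊛-cong {f = f} (λ _ → refl) q

  ≐-refl : ∀ {f} → f ≐ f
  ≐-refl _ = refl

  deriv-cst : ∀ k → deriv (cst k) ≐ zeroS
  deriv-cst k _ = ℤP.*-zeroʳ k

  deriv-cst⊛ : ∀ k f → deriv (cst k ⊛ f) ≐ (cst k ⊛ deriv f)
  deriv-cst⊛ k f n = trans (sym (scale≐cst⊛ k f (suc n))) (scale≐cst⊛ k (deriv f) n)

  deriv-S : deriv S ≐ (cst (+ 3) ⊛ C)
  deriv-S n = trans (S-deriv n) (scale≐cst⊛ (+ 3) C n)

  deriv-C : deriv C ≐ negS S
  deriv-C = C-deriv

  same-derivative : ∀ {f g} → f 0 ≡ g 0 → deriv f ≐ deriv g → f ≐ g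
  same-derivative f₀≡g₀ f′≐g′ zero    = f₀≡g₀
  same-derivative f₀≡g₀ f′≐g′ (suc n) = f′≐g′ n

  -- sin² + cos² = 1, in the form S² + 3C² = 3: the left side has
  -- derivative 2·S·3C + 3·2·C·(−S) = 0 and constant term 3.
  pythagoras : ((S ⊛ S) ⊕ (cst (+ 3) ⊛ (C ⊛ C))) ≐ cst (+ 3)
  pythagoras = same-derivative refl (begin
    deriv ((S ⊛ S) ⊕ (cst (+ 3) ⊛ (C ⊛ C)))
      ≈⟨ leibniz S S ⟨⊕⟩ deriv-cst⊛ (+ 3) (C ⊛ C) ⟩
    ((deriv S ⊛ S) ⊕ (S ⊛ deriv S)) ⊕ (cst (+ 3) ⊛ deriv (C ⊛ C))
      ≈⟨ (⊛-congˡ S deriv-S ⟨⊕⟩ ⊛-congʳ S deriv-S)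
         ⟨⊕⟩ ⊛-congʳ (cst (+ 3)) (λ n → trans (leibniz C C n) ((⊛-congˡ C deriv-C ⟨⊕⟩ ⊛-congʳ C deriv-C) n)) ⟩
    (((cst (+ 3) ⊛ C) ⊛ S) ⊕ (S ⊛ (cst (+ 3) ⊛ C))) ⊕ (cst (+ 3) ⊛ ((negS S ⊛ C) ⊕ (C ⊛ negS S)))
      ≈⟨ solve 2 (λ s c → (((con (+ 3) :* c) :* s) :+ (s :* (con (+ 3) :* c)))
                          :+ (con (+ 3) :* (((:- s) :* c) :+ (c :* (:- s)))) := con (+ 0))
               (λ _ → refl) S C ⟩
    cst (+ 0)
      ≈⟨ (λ n → sym (deriv-cst (+ 3) n)) ⟩
    deriv (cst (+ 3)) ∎)

  deriv-trig : ∀ a b k → deriv (((cst a ⊛ S) ⊕ (cst b ⊛ C)) ⊕ cst k)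
                         ≐ ((cst a ⊛ (cst (+ 3) ⊛ C)) ⊕ (cst b ⊛ negS S))
  deriv-trig a b k n =
    trans (cong (λ y → (deriv (cst a ⊛ S) ⊕ deriv (cst b ⊛ C)) n + y) (deriv-cst k n))
          (trans (ℤP.+-identityʳ _)
                 ((derivTerm a S (cst (+ 3) ⊛ C) deriv-S ⟨⊕⟩ derivTerm b C (negS S) deriv-C) n))
    where
    derivTerm : ∀ c F F′ → deriv F ≐ F′ → deriv (cst c ⊛ F) ≐ (cst c ⊛ F′)
    derivTerm c F F′ F′≐ m = trans (deriv-cst⊛ c F m) (⊛-congʳ (cst c) F′≐ m)

  D D′ : EGF
  D  = ((cst (- (+ 3)) ⊛ S) ⊕ (cst (+ 3) ⊛ C)) ⊕ cst (+ 6)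
  D′ = (cst (- (+ 9)) ⊛ C) ⊕ (cst (- (+ 3)) ⊛ S)

  deriv-D : deriv D ≐ D′
  deriv-D = begin
    deriv D
      ≈⟨ deriv-trig (- (+ 3)) (+ 3) (+ 6) ⟩
    (cst (- (+ 3)) ⊛ (cst (+ 3) ⊛ C)) ⊕ (cst (+ 3) ⊛ negS S)
      ≈⟨ solve 2 (λ s c → (con (- (+ 3)) :* (con (+ 3) :* c)) :+ (con (+ 3) :* (:- s))
                          := (con (- (+ 9)) :* c) :+ (con (- (+ 3)) :* s))
               (λ _ → refl) S C ⟩
    D′ ∎

  Causal : (EGF → EGF) → Set
  Causal Φ = ∀ P Q n → (∀ j → j ≤ n → P j ≡ Q j) → Φ P n ≡ Φ Q n

  -- Uniqueness for first-order equations P′·D = Φ(P): when D(0) ≠ 0 and Φ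
  -- is causal, coefficient n of the equation determines P(n+1) from
  -- P(0), …, P(n), so a solution is fixed by its constant term.
  ode-unique : ∀ E Φ → E 0 ≢ + 0 → Causal Φ → ∀ {P Q} →
               (deriv P ⊛ E) ≐ Φ P → (deriv Q ⊛ E) ≐ Φ Q → P 0 ≡ Q 0 → P ≐ Q
  ode-unique E Φ E₀≢0 causal {P} {Q} eqP eqQ P₀≡Q₀ n = agreeUpTo n n ℕP.≤-refl
    where
    nextCoefficient : ∀ n → (∀ j → j ≤ n → P j ≡ Q j) → P (suc n) ≡ Q (suc n)
    nextCoefficient n agree =
      ℤP.*-cancelʳ-≡ (P (suc n)) (Q (suc n)) (E 0) {{ℤ.≢-nonZero E₀≢0}}
        (sym (∙-cancelˡ ((deriv Q ⊛ E) n) (Q (suc n) * E 0) (P (suc n) * E 0) topDifference))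
      where
      sameProduct : (deriv P ⊛ E) n ≡ (deriv Q ⊛ E) n
      sameProduct = trans (eqP n) (trans (causal P Q n agree) (sym (eqQ n)))
      topDifference : (deriv Q ⊛ E) n + Q (suc n) * E 0 ≡ (deriv Q ⊛ E) n + P (suc n) * E 0
      topDifference = trans (cong (_+ Q (suc n) * E 0) (sym sameProduct))
                            (⊛-top n (deriv P) (deriv Q) E (λ j j<n → agree (suc j) j<n))
    agreeUpTo : ∀ n j → j ≤ n → P j ≡ Q j
    agreeUpTo zero    .zero z≤n = P₀≡Q₀
    agreeUpTo (suc n) j j≤1+n with ℕP.m≤n⇒m<n∨m≡n j≤1+n
    ... | inj₁ j<1+n = agreeUpTo n j (ℕP.m<1+n⇒m≤n j<1+n)
    ... | inj₂ refl  = nextCoefficient n (agreeUpTo n)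

  D-poly D′-poly R-poly : ∀ {m} → Polynomial m → Polynomial m → Polynomial m
  D-poly  s c = ((con (- (+ 3)) :* s) :+ (con (+ 3) :* c)) :+ con (+ 6)
  D′-poly s c = (con (- (+ 9)) :* c) :+ (con (- (+ 3)) :* s)
  R-poly  s c = ((con (+ 3) :* s) :+ (con (+ 3) :* c)) :+ con (- (+ 3))

  -- The right-hand side of the equation P′·D = P·D′ + D² + P·D + P²
  -- satisfied by P = T·D whenever T′ = 1 + T + T².
  riccati : EGF → EGF
  riccati P = ((P ⊛ D′) ⊕ (D ⊛ D)) ⊕ ((P ⊛ D) ⊕ (P ⊛ P))

  riccati-poly : ∀ {m} → Polynomial m → Polynomial m → Polynomial m → Polynomial m
  riccati-poly p s c = ((p :* D′-poly s c) :+ (D-poly s c :* D-poly s c)) :+ ((p :* D-poly s c) :+ (p :* p))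

  riccati-causal : Causal riccati
  riccati-causal P Q n agree =
    cong₂ _+_ (cong (_+ (D ⊛ D) n) (⊛-local {g = D′} n agree (λ _ _ → refl)))
              (cong₂ _+_ (⊛-local {g = D} n agree (λ _ _ → refl)) (⊛-local n agree agree))

  D₀≢0 : D 0 ≢ + 0
  D₀≢0 ()

  -- The series R = 3S + 3C − 3 solves the same equation;
  -- the verification is a polynomial identity modulo S² + 3C² = 3.
  R : EGF
  R = ((cst (+ 3) ⊛ S) ⊕ (cst (+ 3) ⊛ C)) ⊕ cst (- (+ 3))

  R-riccati : (deriv R ⊛ D) ≐ riccati R
  R-riccati = begin
    deriv R ⊛ D
      ≈⟨ ⊛-congˡ D (deriv-trig (+ 3) (+ 3) (- (+ 3))) ⟩
    ((cst (+ 3) ⊛ (cst (+ 3) ⊛ C)) ⊕ (cst (+ 3) ⊛ negS S)) ⊛ D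
      ≈⟨ solve 3 (λ s c q → ((con (+ 3) :* (con (+ 3) :* c)) :+ (con (+ 3) :* (:- s))) :* D-poly s c
                            := riccati-poly (R-poly s c) s c
                               :+ con (+ 9) :* (((s :* s) :+ (con (+ 3) :* (c :* c))) :- con (+ 3)))
               (λ _ → refl) S C ((S ⊛ S) ⊕ (cst (+ 3) ⊛ (C ⊛ C))) ⟩
    riccati R ⊕ (cst (+ 9) ⊛ (((S ⊛ S) ⊕ (cst (+ 3) ⊛ (C ⊛ C))) ⊕ negS (cst (+ 3))))
      ≈⟨ ≐-refl {riccati R} ⟨⊕⟩ ⊛-congʳ (cst (+ 9)) (pythagoras ⟨⊕⟩ ≐-refl {negS (cst (+ 3))}) ⟩
    riccati R ⊕ (cst (+ 9) ⊛ (cst (+ 3) ⊕ negS (cst (+ 3))))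
      ≈⟨ solve 1 (λ x → x :+ con (+ 9) :* (con (+ 3) :- con (+ 3)) := x) (λ _ → refl) (riccati R) ⟩
    riccati R ∎

  one≐cst1 : one ≐ cst (+ 1)
  one≐cst1 n = sym (ℤP.*-identityˡ (one n))

  deriv-numer : deriv numer ≐ D
  deriv-numer n = trans (cong₂ (λ a b → + 6 * a + (b + (+ 3 * C (suc n) + - (+ 3) * + 0)))
                               (zS-deriv n) (S-deriv n))
                 (trans (cong (λ a → + 6 * one n + (+ 3 * C n + (+ 3 * a + - (+ 3) * + 0))) (C-deriv n))
                 (trans (rearrange (one n) (S n) (C n))
                        (cong₂ (λ a b → (a + b) + + 6 * one n) (scale≐cst⊛ (- (+ 3)) S n) (scale≐cst⊛ (+ 3) C n))))
    where
    zS-deriv : ∀ n → zS (suc n) ≡ one n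
    zS-deriv zero    = refl
    zS-deriv (suc n) = refl
    rearrange : ∀ o x y → + 6 * o + (+ 3 * y + (+ 3 * (- x) + - (+ 3) * + 0))
                          ≡ ((- (+ 3)) * x + (+ 3) * y) + (+ 6) * o
    rearrange = solve-∀

  denom≐D : denom ≐ D
  denom≐D n = trans (rearrange (S n) (C n) (one n))
    (cong₂ (λ a b → (a + b) + + 6 * one n) (scale≐cst⊛ (- (+ 3)) S n) (scale≐cst⊛ (+ 3) C n))
    where
    rearrange : ∀ x y o → (- (+ 3)) * x + ((+ 3) * y + (+ 6) * o) ≡ ((- (+ 3)) * x + (+ 3) * y) + (+ 6) * o
    rearrange = solve-∀

  -- The equation of the tree EGF: if T(0) = 0 and T′ = 1 + T + T², then
  -- P = T·D solves the Riccati equation, hence T·D = R by uniqueness.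
  riccati-solution : ∀ T → T 0 ≡ + 0 → deriv T ≐ ((one ⊕ T) ⊕ (T ⊛ T)) → (T ⊛ D) ≐ R
  riccati-solution T T₀ T-ode =
    ode-unique D riccati D₀≢0 riccati-causal TD-riccati R-riccati (cong (λ t → + 1 * t * D 0) T₀)
    where
    TD-riccati : (deriv (T ⊛ D) ⊛ D) ≐ riccati (T ⊛ D)
    TD-riccati = begin
      deriv (T ⊛ D) ⊛ D
        ≈⟨ ⊛-congˡ D (λ n → trans (leibniz T D n)
             ((⊛-congˡ D (λ m → trans (T-ode m) ((one≐cst1 ⟨⊕⟩ ≐-refl {T} ⟨⊕⟩ ≐-refl {T ⊛ T}) m))
               ⟨⊕⟩ ⊛-congʳ T deriv-D) n)) ⟩
      ((((cst (+ 1) ⊕ T) ⊕ (T ⊛ T)) ⊛ D) ⊕ (T ⊛ D′)) ⊛ D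
        ≈⟨ solve 3 (λ t d d′ → ((((con (+ 1) :+ t) :+ (t :* t)) :* d) :+ (t :* d′)) :* d
                               := (((t :* d) :* d′) :+ (d :* d)) :+ (((t :* d) :* d) :+ ((t :* d) :* (t :* d))))
                 (λ _ → refl) T D D′ ⟩
      riccati (T ⊛ D) ∎

  -- The equation of the leaf EGF: if T·D = R, L(0) = 0 and
  -- L′ = L·T + T·L + L + 1, then (L·D)′ = 2·L·R + L·D + D + L·D′ = D, so
  -- L·D equals the numerator N.
  linear-solution : ∀ T L → (T ⊛ D) ≐ R → L 0 ≡ + 0 → deriv L ≐ (((L ⊛ T) ⊕ (T ⊛ L)) ⊕ (L ⊕ one)) →
                    (L ⊛ denom) ≐ numer
  linear-solution T L T⊛D≐R L₀ L-ode n =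
    trans (⊛-congʳ L denom≐D n)
          (same-derivative {L ⊛ D} {numer} (cong (λ l → + 1 * l * D 0) L₀)
                           (λ m → trans (deriv-LD m) (sym (deriv-numer m))) n)
    where
    deriv-LD : deriv (L ⊛ D) ≐ D
    deriv-LD = begin
      deriv (L ⊛ D)
        ≈⟨ (λ n → trans (leibniz L D n)
             ((⊛-congˡ D (λ m → trans (L-ode m) ((≐-refl {(L ⊛ T) ⊕ (T ⊛ L)} ⟨⊕⟩ (≐-refl {L} ⟨⊕⟩ one≐cst1)) m))
               ⟨⊕⟩ ⊛-congʳ L deriv-D) n)) ⟩
      ((((L ⊛ T) ⊕ (T ⊛ L)) ⊕ (L ⊕ cst (+ 1))) ⊛ D) ⊕ (L ⊛ D′)
        ≈⟨ solve 4 (λ l t d d′ → ((((l :* t) :+ (t :* l)) :+ (l :+ con (+ 1))) :* d) :+ (l :* d′)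
                                 := (con (+ 2) :* (l :* (t :* d)) :+ l :* d) :+ (d :+ l :* d′))
                 (λ _ → refl) L T D D′ ⟩
      ((cst (+ 2) ⊛ (L ⊛ (T ⊛ D))) ⊕ (L ⊛ D)) ⊕ (D ⊕ (L ⊛ D′))
        ≈⟨ ⊛-congʳ (cst (+ 2)) (⊛-congʳ L T⊛D≐R) ⟨⊕⟩ ≐-refl {L ⊛ D} ⟨⊕⟩ ≐-refl {D ⊕ (L ⊛ D′)} ⟩
      ((cst (+ 2) ⊛ (L ⊛ R)) ⊕ (L ⊛ D)) ⊕ (D ⊕ (L ⊛ D′))
        ≈⟨ solve 3 (λ l s c → (con (+ 2) :* (l :* R-poly s c) :+ l :* D-poly s c) :+ (D-poly s c :+ l :* D′-poly s c)
                              := D-poly s c)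
                 (λ _ → refl) L S C ⟩
      D ∎

  symmetric-ode : ∀ T L → deriv L ≐ (((L ⊛ T) ⊕ (T ⊛ L)) ⊕ (L ⊕ one)) →
                  deriv L ≐ (scale (+ 2) (L ⊛ T) ⊕ (L ⊕ one))
  symmetric-ode T L L-ode n = trans (L-ode n) (cong (_+ (L ⊕ one) n)
    (trans (cong (λ y → (L ⊛ T) n + y) (⊛-comm T L n)) (double ((L ⊛ T) n))))
    where
    double : ∀ x → x + x ≡ + 2 * x
    double = solve-∀

module FiniteSums where

  open import Data.Nat using (ℕ; suc; _+_; _*_)
  import Data.Nat.Properties as ℕP
  open import Data.Nat.Tactic.RingSolver using (solve-∀)
  open import Data.Nat.ListAction using (sum)
  open import Data.List using (List; []; _∷_; _++_; map; concatMap; filter; length)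
  open import Data.List.Membership.Propositional using (_∈_)
  open import Data.List.Relation.Unary.Any using (here; there)
  import Data.List.Relation.Unary.All as All
  open import Data.List.Relation.Unary.Unique.Propositional using (Unique)
  open import Data.List.Relation.Unary.AllPairs using (_∷_)
  open import Data.Empty using (⊥-elim)
  open import Relation.Nullary using (Dec; yes; no)
  open import Relation.Unary using (Pred; Decidable)
  open import Relation.Binary.PropositionalEquality using (_≡_; _≢_; refl; sym; trans; cong; cong₂)

  private variable
    A B : Set

  ∑ : List A → (A → ℕ) → ℕ
  ∑ []       f = 0
  ∑ (x ∷ xs) f = f x + ∑ xs f

  ∑-cong : ∀ (xs : List A) {f g} → (∀ x → x ∈ xs → f x ≡ g x) → ∑ xs f ≡ ∑ xs g
  ∑-cong []       eq = refl
  ∑-cong (x ∷ xs) eq = cong₂ _+_ (eq x (here refl)) (∑-cong xs (λ y y∈ → eq y (there y∈)))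

  ∑-++ : ∀ (xs ys : List A) f → ∑ (xs ++ ys) f ≡ ∑ xs f + ∑ ys f
  ∑-++ []       ys f = refl
  ∑-++ (x ∷ xs) ys f = trans (cong (f x +_) (∑-++ xs ys f)) (sym (ℕP.+-assoc (f x) _ _))

  ∑-map : ∀ (g : A → B) xs f → ∑ (map g xs) f ≡ ∑ xs (λ x → f (g x))
  ∑-map g []       f = refl
  ∑-map g (x ∷ xs) f = cong (f (g x) +_) (∑-map g xs f)

  ∑-concatMap : ∀ (g : A → List B) xs f → ∑ (concatMap g xs) f ≡ ∑ xs (λ x → ∑ (g x) f)
  ∑-concatMap g []       f = refl
  ∑-concatMap g (x ∷ xs) f =
    trans (∑-++ (g x) (concatMap g xs) f) (cong (∑ (g x) f +_) (∑-concatMap g xs f))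

  ∑-+ : ∀ (xs : List A) f g → ∑ xs (λ x → f x + g x) ≡ ∑ xs f + ∑ xs g
  ∑-+ []       f g = refl
  ∑-+ (x ∷ xs) f g = trans (cong (f x + g x +_) (∑-+ xs f g)) (interchange (f x) (g x) (∑ xs f) (∑ xs g))
    where
    interchange : ∀ a b c d → a + b + (c + d) ≡ a + c + (b + d)
    interchange = solve-∀

  ∑-*ˡ : ∀ (xs : List A) c f → ∑ xs (λ x → c * f x) ≡ c * ∑ xs f
  ∑-*ˡ []       c f = sym (ℕP.*-zeroʳ c)
  ∑-*ˡ (x ∷ xs) c f = trans (cong (c * f x +_) (∑-*ˡ xs c f)) (sym (ℕP.*-distribˡ-+ c (f x) (∑ xs f)))

  ∑-*ʳ : ∀ (xs : List A) c f → ∑ xs (λ x → f x * c) ≡ ∑ xs f * c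
  ∑-*ʳ xs c f = trans (∑-cong xs (λ x _ → ℕP.*-comm (f x) c)) (trans (∑-*ˡ xs c f) (ℕP.*-comm c (∑ xs f)))

  ∑-product : ∀ (xs : List A) (ys : List B) a b → ∑ xs (λ x → ∑ ys (λ y → a x * b y)) ≡ ∑ xs a * ∑ ys b
  ∑-product xs ys a b = trans (∑-cong xs (λ x _ → ∑-*ˡ ys (a x) b)) (∑-*ʳ xs (∑ ys b) a)

  ∑-zero : ∀ (xs : List A) f → (∀ x → x ∈ xs → f x ≡ 0) → ∑ xs f ≡ 0
  ∑-zero []       f z = refl
  ∑-zero (x ∷ xs) f z = cong₂ _+_ (z x (here refl)) (∑-zero xs f (λ y y∈ → z y (there y∈)))

  ∑-swap : ∀ (xs : List A) (ys : List B) (f : A → B → ℕ) →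
           ∑ xs (λ x → ∑ ys (f x)) ≡ ∑ ys (λ y → ∑ xs (λ x → f x y))
  ∑-swap []       ys f = sym (∑-zero ys _ (λ _ _ → refl))
  ∑-swap (x ∷ xs) ys f =
    trans (cong (∑ ys (f x) +_) (∑-swap xs ys f)) (sym (∑-+ ys (f x) (λ y → ∑ xs (λ x′ → f x′ y))))

  ∑-single : ∀ (xs : List A) f m → Unique xs → m ∈ xs → (∀ x → x ∈ xs → x ≢ m → f x ≡ 0) → ∑ xs f ≡ f m
  ∑-single (x ∷ xs) f m (x∉xs ∷ u) (here refl) z =
    trans (cong (f x +_) (∑-zero xs f (λ y y∈ → z y (there y∈) (λ y≡x → All.lookup x∉xs y∈ (sym y≡x)))))
          (ℕP.+-identityʳ (f x))
  ∑-single (x ∷ xs) f m (x∉xs ∷ u) (there m∈) z =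
    trans (cong (_+ ∑ xs f) (z x (here refl) (All.lookup x∉xs m∈)))
          (∑-single xs f m u m∈ (λ y y∈ → z y (there y∈)))

  𝟙 : {P : Set} → Dec P → ℕ
  𝟙 (yes _) = 1
  𝟙 (no _)  = 0

  𝟙-cong : {P Q : Set} → (P → Q) → (Q → P) → (d : Dec P) (e : Dec Q) → 𝟙 d ≡ 𝟙 e
  𝟙-cong f g (yes p) (yes q) = refl
  𝟙-cong f g (yes p) (no ¬q) = ⊥-elim (¬q (f p))
  𝟙-cong f g (no ¬p) (yes q) = ⊥-elim (¬p (g q))
  𝟙-cong f g (no ¬p) (no ¬q) = refl

  sum-filter : ∀ {P : Pred A _} (P? : Decidable P) (w : A → ℕ) xs →
               sum (map w (filter P? xs)) ≡ ∑ xs (λ x → 𝟙 (P? x) * w x)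
  sum-filter P? w []       = refl
  sum-filter P? w (x ∷ xs) with P? x
  ... | yes _ = cong₂ _+_ (sym (ℕP.+-identityʳ (w x))) (sum-filter P? w xs)
  ... | no _  = sum-filter P? w xs

  length-filter : ∀ {P : Pred A _} (P? : Decidable P) xs → length (filter P? xs) ≡ ∑ xs (λ x → 𝟙 (P? x) * 1)
  length-filter P? []       = refl
  length-filter P? (x ∷ xs) with P? x
  ... | yes _ = cong suc (length-filter P? xs)
  ... | no _  = length-filter P? xs

module Splits where

  open import Data.Nat using (ℕ; _≤_; _<_; z≤n; s≤s)
  import Data.Nat.Properties as ℕP
  open import Data.List using (List; []; _∷_; _++_; map; filter; length)
  open import Data.List.Membership.Propositional using (_∈_)
  open import Data.List.Membership.Propositional.Properties using (∈-map⁺; ∈-map⁻; ∈-++⁺ˡ; ∈-++⁺ʳ; ∈-++⁻)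
  open import Data.List.Relation.Unary.Any using (here; there)
  open import Data.List.Relation.Unary.All as All using (All; []; _∷_)
  import Data.List.Relation.Unary.All.Properties as AllP
  open import Data.List.Relation.Unary.AllPairs using ([]; _∷_)
  open import Data.List.Relation.Unary.Unique.Propositional using (Unique)
  import Data.List.Relation.Unary.Unique.Propositional.Properties as Unique
  open import Data.List.Relation.Binary.Subset.Propositional using (_⊆_)
  open import Data.Empty using (⊥; ⊥-elim)
  open import Data.Unit using (⊤; tt)
  import Data.Sum
  open import Data.Sum using (_⊎_; inj₁; inj₂)
  open import Data.Product using (_×_; _,_; proj₁; proj₂; Σ-syntax)
  open import Relation.Nullary using (¬_; ¬?; yes; no)
  open import Relation.Unary using (Pred; Decidable)
  open import Relation.Binary.PropositionalEquality using (_≡_; refl; sym; cong)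
  open import Level using (0ℓ)

  private variable
    A : Set

  toLeft toRight : A → List A × List A → List A × List A
  toLeft  x (L , R) = (x ∷ L , R)
  toRight x (L , R) = (L , x ∷ R)

  -- splits xs lists the 2^|xs| ways of distributing the entries of xs
  -- into an ordered pair (L, R) of order-preserving sublists.
  splits : List A → List (List A × List A)
  splits []       = ([] , []) ∷ []
  splits (x ∷ xs) = map (toLeft x) (splits xs) ++ map (toRight x) (splits xs)

  splits-∷⁻ : ∀ {x : A} {xs L R} → (L , R) ∈ splits (x ∷ xs) →
              (Σ[ L′ ∈ List A ] (L ≡ x ∷ L′ × (L′ , R) ∈ splits xs))
            ⊎ (Σ[ R′ ∈ List A ] (R ≡ x ∷ R′ × (L , R′) ∈ splits xs))
  splits-∷⁻ {x = x} {xs} p∈ with ∈-++⁻ (map (toLeft x) (splits xs)) p∈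
  ... | inj₁ q∈ with ∈-map⁻ (toLeft x) q∈
  ...   | (L′ , R′) , q∈s , refl = inj₁ (L′ , refl , q∈s)
  splits-∷⁻ {x = x} {xs} p∈ | inj₂ q∈ with ∈-map⁻ (toRight x) q∈
  ...   | (L′ , R′) , q∈s , refl = inj₂ (R′ , refl , q∈s)

  splits-⊆ : ∀ (xs : List A) {L R} → (L , R) ∈ splits xs → (L ⊆ xs) × (R ⊆ xs)
  splits-⊆ []       (here refl) = (λ ()) , (λ ())
  splits-⊆ (x ∷ xs) p∈ with splits-∷⁻ {xs = xs} p∈
  ... | inj₁ (L′ , refl , q) = (λ { (here refl) → here refl ; (there y∈) → there (proj₁ (splits-⊆ xs q) y∈) })
                             , (λ y∈ → there (proj₂ (splits-⊆ xs q) y∈))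
  ... | inj₂ (R′ , refl , q) = (λ y∈ → there (proj₁ (splits-⊆ xs q) y∈))
                             , (λ { (here refl) → here refl ; (there y∈) → there (proj₂ (splits-⊆ xs q) y∈) })

  splits-cover : ∀ (xs : List A) {L R y} → (L , R) ∈ splits xs → y ∈ xs → y ∈ L ⊎ y ∈ R
  splits-cover (x ∷ xs) p∈ y∈ with splits-∷⁻ {xs = xs} p∈ | y∈
  ... | inj₁ (_ , refl , _) | here refl = inj₁ (here refl)
  ... | inj₂ (_ , refl , _) | here refl = inj₂ (here refl)
  ... | inj₁ (_ , refl , q) | there y∈′ = Data.Sum.map₁ there (splits-cover xs q y∈′)
  ... | inj₂ (_ , refl , q) | there y∈′ = Data.Sum.map₂ there (splits-cover xs q y∈′)

  splits-disjoint : ∀ (xs : List A) {L R y} → Unique xs → (L , R) ∈ splits xs → y ∈ L → y ∈ R → ⊥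
  splits-disjoint []       []         (here refl) () _
  splits-disjoint (x ∷ xs) (x∉xs ∷ u) p∈ yL yR with splits-∷⁻ {xs = xs} p∈
  ... | inj₁ (_ , refl , q) with yL
  ...   | here refl = All.lookup x∉xs (proj₂ (splits-⊆ xs q) yR) refl
  ...   | there yL′ = splits-disjoint xs u q yL′ yR
  splits-disjoint (x ∷ xs) (x∉xs ∷ u) p∈ yL yR | inj₂ (_ , refl , q) with yR
  ...   | here refl = All.lookup x∉xs (proj₁ (splits-⊆ xs q) yL) refl
  ...   | there yR′ = splits-disjoint xs u q yL yR′

  splits-length : ∀ (xs : List A) {L R} → (L , R) ∈ splits xs → length L ≤ length xs × length R ≤ length xs
  splits-length []       (here refl) = z≤n , z≤n
  splits-length (x ∷ xs) p∈ with splits-∷⁻ {xs = xs} p∈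
  ... | inj₁ (_ , refl , q) = s≤s (proj₁ (splits-length xs q)) , ℕP.m≤n⇒m≤1+n (proj₂ (splits-length xs q))
  ... | inj₂ (_ , refl , q) = ℕP.m≤n⇒m≤1+n (proj₁ (splits-length xs q)) , s≤s (proj₂ (splits-length xs q))

  splits-filter : ∀ {P : Pred A 0ℓ} (P? : Decidable P) xs →
                  (filter P? xs , filter (λ y → ¬? (P? y)) xs) ∈ splits xs
  splits-filter P? []       = here refl
  splits-filter P? (x ∷ xs) with P? x
  ... | yes _ = ∈-++⁺ˡ (∈-map⁺ (toLeft x) (splits-filter P? xs))
  ... | no _  = ∈-++⁺ʳ (map (toLeft x) (splits xs)) (∈-map⁺ (toRight x) (splits-filter P? xs))

  splits-unique : ∀ (xs : List A) → Unique xs → Unique (splits xs)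
  splits-unique []       _          = [] ∷ []
  splits-unique (x ∷ xs) (x∉xs ∷ u) =
    Unique.++⁺ (Unique.map⁺ left-injective IH) (Unique.map⁺ right-injective IH) leftRightDisjoint
    where
    IH = splits-unique xs u
    left-injective : ∀ {p q} → toLeft x p ≡ toLeft x q → p ≡ q
    left-injective {_ , _} {_ , _} refl = refl
    right-injective : ∀ {p q} → toRight x p ≡ toRight x q → p ≡ q
    right-injective {_ , _} {_ , _} refl = refl
    -- a split putting x on the left is not one putting x on the right,
    -- since x does not occur in xs
    leftRightDisjoint : ∀ {v} → ¬ (v ∈ map (toLeft x) (splits xs) × v ∈ map (toRight x) (splits xs))
    leftRightDisjoint (v∈ˡ , v∈ʳ) with ∈-map⁻ (toLeft x) v∈ˡ | ∈-map⁻ (toRight x) v∈ʳ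
    ... | (_ , _) , _ , refl | (_ , _) , q∈ , refl = All.lookup x∉xs (proj₁ (splits-⊆ xs q∈) (here refl)) refl

  -- Strictly decreasing lists of naturals: canonical representations of
  -- finite label sets.
  Descending : List ℕ → Set
  Descending []       = ⊤
  Descending (x ∷ xs) = All (_< x) xs × Descending xs

  Descending⇒Unique : ∀ xs → Descending xs → Unique xs
  Descending⇒Unique []       _        = []
  Descending⇒Unique (x ∷ xs) (xs<x , d) =
    All.map (λ y<x x≡y → ℕP.<-irrefl (sym x≡y) y<x) xs<x ∷ Descending⇒Unique xs d

  splits-descending : ∀ xs {L R} → Descending xs → (L , R) ∈ splits xs → Descending L × Descending R
  splits-descending []       _          (here refl) = tt , tt
  splits-descending (x ∷ xs) (xs<x , d) p∈ with splits-∷⁻ {xs = xs} p∈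
  ... | inj₁ (_ , refl , q) = (AllP.anti-mono (proj₁ (splits-⊆ xs q)) xs<x , proj₁ (splits-descending xs d q))
                            , proj₂ (splits-descending xs d q)
  ... | inj₂ (_ , refl , q) = proj₁ (splits-descending xs d q)
                            , (AllP.anti-mono (proj₂ (splits-⊆ xs q)) xs<x , proj₂ (splits-descending xs d q))

  head-bound : ∀ {a b as bs} → (a ∷ as) ⊆ (b ∷ bs) → All (_< b) bs → a ≤ b
  head-bound a∷as⊆ bs<b with a∷as⊆ (here refl)
  ... | here refl = ℕP.≤-refl
  ... | there a∈  = ℕP.<⇒≤ (All.lookup bs<b a∈)

  drop-head : ∀ {x as bs} → (x ∷ as) ⊆ (x ∷ bs) → All (_< x) as → as ⊆ bs
  drop-head as⊆ as<x z∈ with as⊆ (there z∈)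
  ... | here refl = ⊥-elim (ℕP.<-irrefl refl (All.lookup as<x z∈))
  ... | there z∈′ = z∈′

  Descending-ext : ∀ xs ys → Descending xs → Descending ys → xs ⊆ ys → ys ⊆ xs → xs ≡ ys
  Descending-ext []       []       _ _ _ _ = refl
  Descending-ext []       (y ∷ ys) _ _ _ ys⊆ with ys⊆ (here refl)
  ... | ()
  Descending-ext (x ∷ xs) []       _ _ xs⊆ _ with xs⊆ (here refl)
  ... | ()
  Descending-ext (x ∷ xs) (y ∷ ys) (xs<x , dx) (ys<y , dy) xs⊆ ys⊆
    with ℕP.≤-antisym (head-bound xs⊆ ys<y) (head-bound ys⊆ xs<x)
  ... | refl = cong (x ∷_) (Descending-ext xs ys dx dy (drop-head xs⊆ xs<x) (drop-head ys⊆ ys<y))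

module RootDecomposition where

  open FiniteSums
  open Splits
  open import Data.Nat using (ℕ; _≤_; _<_; _*_)
  import Data.Nat.Properties as ℕP
  open import Data.List using (List; []; _∷_; _++_; filter)
  open import Data.List.Membership.Propositional using (_∈_)
  open import Data.List.Membership.DecPropositional ℕP._≟_ using (_∈?_)
  open import Data.List.Membership.Propositional.Properties using (∈-++⁺ˡ; ∈-++⁺ʳ; ∈-++⁻; ∈-filter⁺; ∈-filter⁻)
  open import Data.List.Relation.Unary.Any using (here; there)
  open import Data.List.Relation.Unary.All as All using (All; []; _∷_; all?)
  import Data.List.Relation.Unary.All.Properties as AllP
  open import Data.List.Relation.Unary.AllPairs using ([]; _∷_)
  open import Data.List.Relation.Unary.Unique.Propositional using (Unique)
  open import Data.List.Relation.Unary.Unique.DecPropositional ℕP._≟_ using (unique?)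
  import Data.List.Relation.Unary.Unique.Propositional.Properties as Unique
  open import Data.Empty using (⊥; ⊥-elim)
  open import Data.Unit using (tt)
  open import Data.Sum using (_⊎_; inj₁; inj₂)
  open import Data.Product using (_×_; _,_; proj₁; proj₂; Σ-syntax)
  open import Relation.Nullary using (Dec; yes; no; ¬_; ¬?; _×-dec_)
  open import Relation.Binary.PropositionalEquality using (_≡_; _≢_; refl; sym; trans; cong₂)

  TreeOn : List ℕ → PTree → Set
  TreeOn S t = Unique (labels t) × All (_∈ S) (labels t) × All (_∈ labels t) S × Decreasing t

  treeOn? : ∀ S t → Dec (TreeOn S t)
  treeOn? S t = unique? (labels t) ×-dec (all? (_∈? S) (labels t) ×-dec (all? (_∈? labels t) S ×-dec decreasing? t))

  root∈labels : ∀ t → rootLabel t ∈ labels t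
  root∈labels (leaf _)       = here refl
  root∈labels (unary _ _)    = here refl
  root∈labels (binary _ _ _) = here refl

  below : ∀ {c ℓ xs} → c < ℓ → All (_≤ c) xs → All (_≤ ℓ) xs
  below c<ℓ = All.map (λ y≤c → ℕP.≤-trans y≤c (ℕP.<⇒≤ c<ℓ))

  labels≤root : ∀ t → Decreasing t → All (_≤ rootLabel t) (labels t)
  labels≤root (leaf ℓ)       _                   = ℕP.≤-refl ∷ []
  labels≤root (unary ℓ c)    (c<ℓ , dc)          = ℕP.≤-refl ∷ below c<ℓ (labels≤root c dc)
  labels≤root (binary ℓ l r) (l<ℓ , r<ℓ , dl , dr) =
    ℕP.≤-refl ∷ AllP.++⁺ (below l<ℓ (labels≤root l dl)) (below r<ℓ (labels≤root r dr))

  no-tree-on-[] : ∀ t → ¬ TreeOn [] t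
  no-tree-on-[] t (_ , ⊆[] , _ , _) with All.lookup ⊆[] (root∈labels t)
  ... | ()

  root-is-max : ∀ m rest t → Descending (m ∷ rest) → TreeOn (m ∷ rest) t → rootLabel t ≡ m
  root-is-max m rest t (rest<m , _) (_ , ⊆S , S⊆ , dec) with All.lookup ⊆S (root∈labels t)
  ... | here eq    = eq
  ... | there root∈rest =
    ⊥-elim (ℕP.<⇒≱ (All.lookup rest<m root∈rest) (All.lookup (labels≤root t dec) (All.lookup S⊆ (here refl))))

  unique-++⁻ : ∀ (xs ys : List ℕ) → Unique (xs ++ ys) → Unique xs × Unique ys × (∀ {y} → y ∈ xs → y ∈ ys → ⊥)
  unique-++⁻ []       ys u          = [] , u , (λ ())
  unique-++⁻ (x ∷ xs) ys (x∉ ∷ u) with unique-++⁻ xs ys u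
  ... | uxs , uys , disjoint =
    AllP.++⁻ˡ xs x∉ ∷ uxs , uys ,
    λ { (here refl) y∈ys → All.lookup (AllP.++⁻ʳ xs x∉) y∈ys refl ; (there y∈xs) y∈ys → disjoint y∈xs y∈ys }

  drop≢ : ∀ {m z : ℕ} {zs} → z ∈ m ∷ zs → z ≢ m → z ∈ zs
  drop≢ (here refl) z≢m = ⊥-elim (z≢m refl)
  drop≢ (there z∈)  _   = z∈

  drop< : ∀ {m z : ℕ} {zs} → z ∈ m ∷ zs → z < m → z ∈ zs
  drop< z∈ z<m = drop≢ z∈ (λ { refl → ℕP.<-irrefl refl z<m })

  emptyIndicator : List ℕ → ℕ
  emptyIndicator []      = 1
  emptyIndicator (_ ∷ _) = 0

  leaf-on : ∀ m rest → Descending (m ∷ rest) → 𝟙 (treeOn? (m ∷ rest) (leaf m)) ≡ emptyIndicator rest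
  leaf-on m []       _ with treeOn? (m ∷ []) (leaf m)
  ... | yes _   = refl
  ... | no ¬on  = ⊥-elim (¬on (([] ∷ []) , (here refl ∷ []) , (here refl ∷ []) , tt))
  leaf-on m (y ∷ ys) (rest<m , _) with treeOn? (m ∷ y ∷ ys) (leaf m)
  ... | no _ = refl
  ... | yes (_ , _ , (_ ∷ here y≡m ∷ _) , _) = ⊥-elim (ℕP.<-irrefl y≡m (All.lookup rest<m (here refl)))

  unary-on : ∀ m rest c → Descending (m ∷ rest) → 𝟙 (treeOn? (m ∷ rest) (unary m c)) ≡ 𝟙 (treeOn? rest c)
  unary-on m rest c (rest<m , _) = 𝟙-cong to from (treeOn? (m ∷ rest) (unary m c)) (treeOn? rest c)
    where
    to : TreeOn (m ∷ rest) (unary m c) → TreeOn rest c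
    to (m∉c ∷ u , _ ∷ ⊆S , _ ∷ S⊆ , _ , dc) =
      u , All.tabulate (λ y∈ → drop≢ (All.lookup ⊆S y∈) (λ y≡m → All.lookup m∉c y∈ (sym y≡m)))
        , All.tabulate (λ y∈ → drop< (All.lookup S⊆ y∈) (All.lookup rest<m y∈)) , dc
    from : TreeOn rest c → TreeOn (m ∷ rest) (unary m c)
    from (u , ⊆S , S⊆ , dc) =
      (All.tabulate (λ y∈ m≡y → ℕP.<-irrefl (sym m≡y) (All.lookup rest<m (All.lookup ⊆S y∈))) ∷ u)
      , (here refl ∷ All.map there ⊆S) , (here refl ∷ All.map there S⊆)
      , All.lookup rest<m (All.lookup ⊆S (root∈labels c)) , dc

  SplitTrees : List ℕ × List ℕ → PTree → PTree → Set
  SplitTrees p l r = TreeOn (proj₁ p) l × TreeOn (proj₂ p) r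

  binary-from-split : ∀ m rest l r {L R} → Descending (m ∷ rest) → (L , R) ∈ splits rest →
                      SplitTrees (L , R) l r → TreeOn (m ∷ rest) (binary m l r)
  binary-from-split m rest l r (rest<m , d) p∈ ((ul , l⊆ , ⊆l , dl) , (ur , r⊆ , ⊆r , dr)) =
    (All.tabulate (λ y∈ m≡y → ℕP.<-irrefl (sym m≡y) (All.lookup rest<m (inRest y∈)))
       ∷ Unique.++⁺ ul ur (λ (y∈l , y∈r) → splits-disjoint rest (Descending⇒Unique rest d) p∈
                                              (All.lookup l⊆ y∈l) (All.lookup r⊆ y∈r)))
    , (here refl ∷ All.tabulate (λ y∈ → there (inRest y∈)))
    , (here refl ∷ All.tabulate covered)
    , All.lookup rest<m (inRest (∈-++⁺ˡ (root∈labels l)))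
    , All.lookup rest<m (inRest (∈-++⁺ʳ (labels l) (root∈labels r))) , dl , dr
    where
    inRest : ∀ {y} → y ∈ labels l ++ labels r → y ∈ rest
    inRest y∈ with ∈-++⁻ (labels l) y∈
    ... | inj₁ y∈l = proj₁ (splits-⊆ rest p∈) (All.lookup l⊆ y∈l)
    ... | inj₂ y∈r = proj₂ (splits-⊆ rest p∈) (All.lookup r⊆ y∈r)
    covered : ∀ {y} → y ∈ rest → y ∈ m ∷ labels l ++ labels r
    covered y∈ with splits-cover rest p∈ y∈
    ... | inj₁ y∈L = there (∈-++⁺ˡ (All.lookup ⊆l y∈L))
    ... | inj₂ y∈R = there (∈-++⁺ʳ (labels l) (All.lookup ⊆r y∈R))

  -- Conversely the labels of l and r split rest (into those in l and the others).
  split-of-binary : ∀ m rest l r → Descending (m ∷ rest) → TreeOn (m ∷ rest) (binary m l r) →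
                    Σ[ p ∈ List ℕ × List ℕ ] (p ∈ splits rest × SplitTrees p l r)
  split-of-binary m rest l r (rest<m , _) (m∉ ∷ u , _ ∷ ⊆S , _ ∷ S⊆ , _ , _ , dl , dr) =
    (L , R) , splits-filter inLeft? rest , (ul , l⊆L , L⊆l , dl) , (ur , r⊆R , R⊆r , dr)
    where
    inLeft? = λ y → y ∈? labels l
    L = filter inLeft? rest
    R = filter (λ y → ¬? (inLeft? y)) rest
    parts = unique-++⁻ (labels l) (labels r) u
    ul = proj₁ parts
    ur = proj₁ (proj₂ parts)
    disjoint = proj₂ (proj₂ parts)
    inRest : ∀ {y} → y ∈ labels l ++ labels r → y ∈ rest
    inRest y∈ = drop≢ (All.lookup ⊆S y∈) (λ y≡m → All.lookup m∉ y∈ (sym y≡m))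
    inChildren : ∀ {y} → y ∈ rest → y ∈ labels l ++ labels r
    inChildren y∈ = drop< (All.lookup S⊆ y∈) (All.lookup rest<m y∈)
    l⊆L : All (_∈ L) (labels l)
    l⊆L = All.tabulate (λ y∈ → ∈-filter⁺ inLeft? (inRest (∈-++⁺ˡ y∈)) y∈)
    L⊆l : All (_∈ labels l) L
    L⊆l = All.tabulate (λ y∈ → proj₂ (∈-filter⁻ inLeft? {xs = rest} y∈))
    r⊆R : All (_∈ R) (labels r)
    r⊆R = All.tabulate (λ y∈ → ∈-filter⁺ (λ y → ¬? (inLeft? y)) (inRest (∈-++⁺ʳ (labels l) y∈))
                                          (λ y∈l → disjoint y∈l y∈))
    R⊆r : All (_∈ labels r) R
    R⊆r = All.tabulate (λ y∈ → let (y∈rest , y∉l) = ∈-filter⁻ (λ y → ¬? (inLeft? y)) {xs = rest} y∈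
                               in rightPart (∈-++⁻ (labels l) (inChildren y∈rest)) y∉l)
      where
      rightPart : ∀ {y} → y ∈ labels l ⊎ y ∈ labels r → ¬ (y ∈ labels l) → y ∈ labels r
      rightPart (inj₁ y∈l) y∉l = ⊥-elim (y∉l y∈l)
      rightPart (inj₂ y∈r) _   = y∈r

  split-unique : ∀ rest l r {p q} → Descending rest → p ∈ splits rest → q ∈ splits rest →
                 SplitTrees p l r → SplitTrees q l r → p ≡ q
  split-unique rest l r {L , R} {L′ , R′} d p∈ q∈ ((_ , l⊆L , L⊆l , _) , (_ , r⊆R , R⊆r , _))
                                                   ((_ , l⊆L′ , L′⊆l , _) , (_ , r⊆R′ , R′⊆r , _)) =
    cong₂ _,_
      (Descending-ext L L′ (proj₁ (splits-descending rest d p∈)) (proj₁ (splits-descending rest d q∈))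
                      (λ y∈ → All.lookup l⊆L′ (All.lookup L⊆l y∈)) (λ y∈ → All.lookup l⊆L (All.lookup L′⊆l y∈)))
      (Descending-ext R R′ (proj₂ (splits-descending rest d p∈)) (proj₂ (splits-descending rest d q∈))
                      (λ y∈ → All.lookup r⊆R′ (All.lookup R⊆r y∈)) (λ y∈ → All.lookup r⊆R (All.lookup R′⊆r y∈)))

  splitIndicator : List ℕ × List ℕ → PTree → PTree → ℕ
  splitIndicator p l r = 𝟙 (treeOn? (proj₁ p) l) * 𝟙 (treeOn? (proj₂ p) r)

  splitIndicator-0 : ∀ p l r → ¬ SplitTrees p l r → splitIndicator p l r ≡ 0
  splitIndicator-0 p l r ¬split with treeOn? (proj₁ p) l | treeOn? (proj₂ p) r
  ... | yes onL | yes onR = ⊥-elim (¬split (onL , onR))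
  ... | yes _   | no _    = refl
  ... | no _    | _       = refl

  splitIndicator-1 : ∀ p l r → SplitTrees p l r → splitIndicator p l r ≡ 1
  splitIndicator-1 p l r (onL , onR) with treeOn? (proj₁ p) l | treeOn? (proj₂ p) r
  ... | yes _    | yes _    = refl
  ... | yes _    | no ¬onR  = ⊥-elim (¬onR onR)
  ... | no ¬onL  | _        = ⊥-elim (¬onL onL)

  binary-on : ∀ m rest l r → Descending (m ∷ rest) →
              𝟙 (treeOn? (m ∷ rest) (binary m l r)) ≡ ∑ (splits rest) (λ p → splitIndicator p l r)
  binary-on m rest l r d with treeOn? (m ∷ rest) (binary m l r)
  ... | no ¬on = sym (∑-zero (splits rest) _ (λ p p∈ →
                   splitIndicator-0 p l r (λ split → ¬on (binary-from-split m rest l r d p∈ split))))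
  ... | yes on with split-of-binary m rest l r d on
  ...   | p₀ , p₀∈ , split₀ = sym (trans
            (∑-single (splits rest) _ p₀ (splits-unique rest (Descending⇒Unique rest (proj₂ d))) p₀∈
               (λ p p∈ p≢p₀ → splitIndicator-0 p l r (λ split → p≢p₀ (split-unique rest l r (proj₂ d) p∈ p₀∈ split split₀))))
            (splitIndicator-1 p₀ l r split₀))

module EnumerationCounts where

  open FiniteSums
  open Splits
  open RootDecomposition
  open import Data.Nat using (ℕ; suc; _+_; _*_; _≤_; s≤s)
  import Data.Nat.Properties as ℕP
  open import Data.Nat.Tactic.RingSolver using (solve-∀)
  open import Data.List using (List; _∷_; _++_; [_]; map; concatMap)
  open import Data.List.Membership.Propositional using (_∈_)
  open import Data.List.Membership.Propositional.Properties using (∈-map⁺; ∈-upTo⁺)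
  open import Data.List.Relation.Unary.Unique.Propositional using (Unique)
  import Data.List.Relation.Unary.Unique.Propositional.Properties as Unique
  open import Data.Empty using (⊥-elim)
  open import Data.Product using (proj₁; proj₂)
  open import Relation.Nullary using (yes; no)
  open import Relation.Binary.PropositionalEquality using (_≡_; _≢_; refl; sym; trans; cong; cong₂)
  open Relation.Binary.PropositionalEquality.≡-Reasoning

  count : (PTree → ℕ) → ℕ → ℕ → List ℕ → ℕ
  count w n h S = ∑ (treesOfHeight< n h) (λ t → 𝟙 (treeOn? S t) * w t)

  #trees #leaves : ℕ → ℕ → List ℕ → ℕ
  #trees  = count (λ _ → 1)
  #leaves = count leaves

  labelRange-unique : ∀ n → Unique (labelRange n)
  labelRange-unique n = Unique.map⁺ ℕP.suc-injective (Unique.upTo⁺ n)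

  labelRange-∈ : ∀ n m → 1 ≤ m → m ≤ n → m ∈ labelRange n
  labelRange-∈ n (suc k) (s≤s _) 1+k≤n = ∈-map⁺ suc (∈-upTo⁺ 1+k≤n)

  candidatesAt : ℕ → ℕ → ℕ → List PTree
  candidatesAt n h ℓ = [ leaf ℓ ] ++ map (unary ℓ) (treesOfHeight< n h)
                       ++ concatMap (λ l → map (binary ℓ l) (treesOfHeight< n h)) (treesOfHeight< n h)

  ∑-candidatesAt : ∀ n h ℓ (g : PTree → ℕ) → ∑ (candidatesAt n h ℓ) g
    ≡ g (leaf ℓ) + (∑ (treesOfHeight< n h) (λ c → g (unary ℓ c))
                   + ∑ (treesOfHeight< n h) (λ l → ∑ (treesOfHeight< n h) (λ r → g (binary ℓ l r))))
  ∑-candidatesAt n h ℓ g = begin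
    ∑ ([ leaf ℓ ] ++ map (unary ℓ) E ++ concatMap (λ l → map (binary ℓ l) E) E) g
      ≡⟨ ∑-++ [ leaf ℓ ] (map (unary ℓ) E ++ concatMap (λ l → map (binary ℓ l) E) E) g ⟩
    (g (leaf ℓ) + 0) + ∑ (map (unary ℓ) E ++ concatMap (λ l → map (binary ℓ l) E) E) g
      ≡⟨ cong₂ _+_ (ℕP.+-identityʳ (g (leaf ℓ))) (∑-++ (map (unary ℓ) E) (concatMap (λ l → map (binary ℓ l) E) E) g) ⟩
    g (leaf ℓ) + (∑ (map (unary ℓ) E) g + ∑ (concatMap (λ l → map (binary ℓ l) E) E) g)
      ≡⟨ cong (g (leaf ℓ) +_) (cong₂ _+_ (∑-map (unary ℓ) E g)
           (trans (∑-concatMap (λ l → map (binary ℓ l) E) E g) (∑-cong E (λ l _ → ∑-map (binary ℓ l) E g)))) ⟩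
    g (leaf ℓ) + (∑ E (λ c → g (unary ℓ c)) + ∑ E (λ l → ∑ E (λ r → g (binary ℓ l r)))) ∎
    where
    E = treesOfHeight< n h

  -- Decomposing a count at the root: only candidates with root label m
  -- (the largest label) contribute.
  count-root : ∀ (w : PTree → ℕ) n h m rest → Descending (m ∷ rest) → 1 ≤ m → m ≤ n →
    count w n (suc h) (m ∷ rest) ≡
      𝟙 (treeOn? (m ∷ rest) (leaf m)) * w (leaf m)
      + (∑ (treesOfHeight< n h) (λ c → 𝟙 (treeOn? (m ∷ rest) (unary m c)) * w (unary m c))
      + ∑ (treesOfHeight< n h) (λ l → ∑ (treesOfHeight< n h) (λ r →
            𝟙 (treeOn? (m ∷ rest) (binary m l r)) * w (binary m l r))))
  count-root w n h m rest d 1≤m m≤n =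
    trans (∑-concatMap (candidatesAt n h) (labelRange n) g)
    (trans (∑-single (labelRange n) _ m (labelRange-unique n) (labelRange-∈ n m 1≤m m≤n) otherRoots)
           (∑-candidatesAt n h m g))
    where
    E = treesOfHeight< n h
    g : PTree → ℕ
    g t = 𝟙 (treeOn? (m ∷ rest) t) * w t
    wrongRoot : ∀ t → rootLabel t ≢ m → g t ≡ 0
    wrongRoot t root≢m with treeOn? (m ∷ rest) t
    ... | yes on = ⊥-elim (root≢m (root-is-max m rest t d on))
    ... | no _   = refl
    otherRoots : ∀ ℓ → ℓ ∈ labelRange n → ℓ ≢ m → ∑ (candidatesAt n h ℓ) g ≡ 0
    otherRoots ℓ _ ℓ≢m = trans (∑-candidatesAt n h ℓ g)
      (cong₂ _+_ (wrongRoot (leaf ℓ) ℓ≢m)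
        (cong₂ _+_ (∑-zero E _ (λ c _ → wrongRoot (unary ℓ c) ℓ≢m))
                   (∑-zero E _ (λ l _ → ∑-zero E _ (λ r _ → wrongRoot (binary ℓ l r) ℓ≢m)))))

  binary-part : ∀ (w : PTree → ℕ) n h m rest → Descending (m ∷ rest) →
    ∑ (treesOfHeight< n h) (λ l → ∑ (treesOfHeight< n h) (λ r →
        𝟙 (treeOn? (m ∷ rest) (binary m l r)) * w (binary m l r)))
    ≡ ∑ (splits rest) (λ p → ∑ (treesOfHeight< n h) (λ l → ∑ (treesOfHeight< n h) (λ r →
        splitIndicator p l r * w (binary m l r))))
  binary-part w n h m rest d = begin
    ∑ E (λ l → ∑ E (λ r → 𝟙 (treeOn? (m ∷ rest) (binary m l r)) * w (binary m l r)))
      ≡⟨ ∑-cong E (λ l _ → ∑-cong E (λ r _ → trans (cong (λ x → x * w (binary m l r)) (binary-on m rest l r d))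
                                                   (sym (∑-*ʳ (splits rest) (w (binary m l r)) (λ p → splitIndicator p l r))))) ⟩
    ∑ E (λ l → ∑ E (λ r → ∑ (splits rest) (λ p → splitIndicator p l r * w (binary m l r))))
      ≡⟨ ∑-cong E (λ l _ → ∑-swap E (splits rest) (λ r p → splitIndicator p l r * w (binary m l r))) ⟩
    ∑ E (λ l → ∑ (splits rest) (λ p → ∑ E (λ r → splitIndicator p l r * w (binary m l r))))
      ≡⟨ ∑-swap E (splits rest) (λ l p → ∑ E (λ r → splitIndicator p l r * w (binary m l r))) ⟩
    ∑ (splits rest) (λ p → ∑ E (λ l → ∑ E (λ r → splitIndicator p l r * w (binary m l r)))) ∎
    where
    E = treesOfHeight< n h

  count-step : ∀ (w : PTree → ℕ) → (∀ ℓ → w (leaf ℓ) ≡ 1) → (∀ ℓ c → w (unary ℓ c) ≡ w c) →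
    ∀ n h m rest → Descending (m ∷ rest) → 1 ≤ m → m ≤ n →
    count w n (suc h) (m ∷ rest) ≡ emptyIndicator rest + (count w n h rest
      + ∑ (splits rest) (λ p → ∑ (treesOfHeight< n h) (λ l → ∑ (treesOfHeight< n h) (λ r →
          splitIndicator p l r * w (binary m l r)))))
  count-step w w-leaf w-unary n h m rest d 1≤m m≤n =
    trans (count-root w n h m rest d 1≤m m≤n)
      (cong₂ _+_ (trans (cong (𝟙 (treeOn? (m ∷ rest) (leaf m)) *_) (w-leaf m))
                        (trans (ℕP.*-identityʳ _) (leaf-on m rest d)))
        (cong₂ _+_ (∑-cong (treesOfHeight< n h) (λ c _ → cong₂ _*_ (unary-on m rest c d) (w-unary m c)))
                   (binary-part w n h m rest d)))

  #trees-step : ∀ n h m rest → Descending (m ∷ rest) → 1 ≤ m → m ≤ n →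
    #trees n (suc h) (m ∷ rest) ≡ emptyIndicator rest
      + (#trees n h rest + ∑ (splits rest) (λ p → #trees n h (proj₁ p) * #trees n h (proj₂ p)))
  #trees-step n h m rest d 1≤m m≤n =
    trans (count-step (λ _ → 1) (λ _ → refl) (λ _ _ → refl) n h m rest d 1≤m m≤n)
      (cong (λ x → emptyIndicator rest + (#trees n h rest + x)) (∑-cong (splits rest) (λ p _ →
        trans (∑-cong E (λ l _ → ∑-cong E (λ r _ → unitWeights (𝟙 (treeOn? (proj₁ p) l)) (𝟙 (treeOn? (proj₂ p) r)))))
              (∑-product E E _ _))))
    where
    E = treesOfHeight< n h
    unitWeights : ∀ a b → a * b * 1 ≡ (a * 1) * (b * 1)
    unitWeights = solve-∀

  #leaves-step : ∀ n h m rest → Descending (m ∷ rest) → 1 ≤ m → m ≤ n →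
    #leaves n (suc h) (m ∷ rest) ≡ emptyIndicator rest
      + (#leaves n h rest + ∑ (splits rest) (λ p → #leaves n h (proj₁ p) * #trees n h (proj₂ p)
                                                   + #trees n h (proj₁ p) * #leaves n h (proj₂ p)))
  #leaves-step n h m rest d 1≤m m≤n =
    trans (count-step leaves (λ _ → refl) (λ _ _ → refl) n h m rest d 1≤m m≤n)
      (cong (λ x → emptyIndicator rest + (#leaves n h rest + x)) (∑-cong (splits rest) (λ p _ →
        trans (∑-cong E (λ l _ → ∑-cong E (λ r _ →
                 leafWeights (𝟙 (treeOn? (proj₁ p) l)) (𝟙 (treeOn? (proj₂ p) r)) (leaves l) (leaves r))))
        (trans (∑-cong E (λ l _ → ∑-+ E _ _))
        (trans (∑-+ E _ _)
               (cong₂ _+_ (∑-product E E _ _) (∑-product E E _ _)))))))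
    where
    E = treesOfHeight< n h
    leafWeights : ∀ a b x y → a * b * (x + y) ≡ (a * x) * (b * 1) + (a * 1) * (b * y)
    leafWeights = solve-∀

module VertexSets where

  open Splits using (Descending; Descending⇒Unique)
  open RootDecomposition using (TreeOn)
  open import Data.Nat using (ℕ; zero; suc; _≤_; _<_; z≤n; s≤s)
  import Data.Nat.Properties as ℕP
  open import Data.List using (List; []; _∷_; length; filter)
  import Data.List.Properties as ListP
  open import Data.List.Membership.Propositional using (_∈_)
  open import Data.List.Membership.DecPropositional ℕP._≟_ using (_∈?_)
  open import Data.List.Membership.Propositional.Properties using (∈-filter⁺)
  open import Data.List.Relation.Unary.Any as Any using (here; there)
  import Data.List.Relation.Unary.All as All
  open import Data.List.Relation.Unary.AllPairs using (_∷_)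
  open import Data.List.Relation.Unary.Unique.Propositional using (Unique)
  open import Data.List.Relation.Binary.Subset.Propositional using (_⊆_)
  open import Data.Empty using (⊥-elim)
  open import Data.Unit using (tt)
  open import Data.Product using (_,_; proj₁; proj₂)
  open import Relation.Nullary using (yes; no; ¬?)
  open import Relation.Binary.PropositionalEquality using (_≡_; refl; sym; cong; subst)

  -- The vertex set [n] as the descending list n, n−1, …, 1.
  vertexList : ℕ → List ℕ
  vertexList zero    = []
  vertexList (suc n) = suc n ∷ vertexList n

  vertexList-length : ∀ n → length (vertexList n) ≡ n
  vertexList-length zero    = refl
  vertexList-length (suc n) = cong suc (vertexList-length n)

  vertexList-∈⁻ : ∀ n {x} → x ∈ vertexList n → InRange n x
  vertexList-∈⁻ (suc n) (here refl) = s≤s z≤n , ℕP.≤-refl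
  vertexList-∈⁻ (suc n) (there x∈) = proj₁ (vertexList-∈⁻ n x∈) , ℕP.m≤n⇒m≤1+n (proj₂ (vertexList-∈⁻ n x∈))

  vertexList-∈⁺ : ∀ n {x} → 1 ≤ x → x ≤ n → x ∈ vertexList n
  vertexList-∈⁺ zero    (s≤s _) ()
  vertexList-∈⁺ (suc n) {x} 1≤x x≤1+n with x ℕP.≟ suc n
  ... | yes refl = here refl
  ... | no x≢1+n = there (vertexList-∈⁺ n 1≤x (ℕP.m<1+n⇒m≤n (ℕP.≤∧≢⇒< x≤1+n x≢1+n)))

  vertexList-descending : ∀ n → Descending (vertexList n)
  vertexList-descending zero    = tt
  vertexList-descending (suc n) = All.tabulate (λ x∈ → s≤s (proj₂ (vertexList-∈⁻ n x∈))) , vertexList-descending n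

  unique⊆⇒length≤ : ∀ (xs ys : List ℕ) → Unique xs → xs ⊆ ys → length xs ≤ length ys
  unique⊆⇒length≤ []       ys _          _   = z≤n
  unique⊆⇒length≤ (x ∷ xs) ys (x∉xs ∷ u) x∷xs⊆ys =
    ℕP.≤-trans (s≤s (unique⊆⇒length≤ xs (filter ≢x? ys) u xs⊆ys∖x))
               (ListP.filter-notAll ≢x? ys (Any.map (λ x≡y x≢y → x≢y (sym x≡y)) (x∷xs⊆ys (here refl))))
    where
    ≢x? = λ y → ¬? (y ℕP.≟ x)
    xs⊆ys∖x : xs ⊆ filter ≢x? ys
    xs⊆ys∖x y∈ = ∈-filter⁺ ≢x? (x∷xs⊆ys (there y∈)) (λ y≡x → All.lookup x∉xs y∈ (sym y≡x))

  fills-vertexList : ∀ n xs → Unique xs → xs ⊆ vertexList n → length xs ≡ n → vertexList n ⊆ xs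
  fills-vertexList n xs u xs⊆ |xs|≡n {y} y∈ with y ∈? xs
  ... | yes y∈xs = y∈xs
  ... | no  y∉xs = ⊥-elim (ℕP.<-irrefl |xs|≡n (ℕP.≤-<-trans |xs|≤ |[n]∖y|<n))
    where
    ≢y? = λ z → ¬? (z ℕP.≟ y)
    |xs|≤ : length xs ≤ length (filter ≢y? (vertexList n))
    |xs|≤ = unique⊆⇒length≤ xs _ u (λ {z} z∈ → ∈-filter⁺ ≢y? (xs⊆ z∈) (λ z≡y → y∉xs (subst (_∈ xs) z≡y z∈)))
    |[n]∖y|<n : length (filter ≢y? (vertexList n)) < n
    |[n]∖y|<n = subst (length (filter ≢y? (vertexList n)) <_) (vertexList-length n)
      (ListP.filter-notAll ≢y? (vertexList n) (Any.map (λ y≡z y≢z → y≢z (sym y≡z)) y∈))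

  labeled⇒treeOn : ∀ n t → IsLabeled12Tree n t → TreeOn (vertexList n) t
  labeled⇒treeOn n t (size≡n , inRange , u , dec) =
    u , labels⊆ , All.tabulate (fills-vertexList n (labels t) u (All.lookup labels⊆) size≡n) , dec
    where
    labels⊆ = All.map (λ (1≤x , x≤n) → vertexList-∈⁺ n 1≤x x≤n) inRange

  treeOn⇒labeled : ∀ n t → TreeOn (vertexList n) t → IsLabeled12Tree n t
  treeOn⇒labeled n t (u , labels⊆ , ⊆labels , dec) =
    ℕP.≤-antisym size≤n n≤size , All.map (vertexList-∈⁻ n) labels⊆ , u , dec
    where
    size≤n : length (labels t) ≤ n
    size≤n = subst (length (labels t) ≤_) (vertexList-length n)
                   (unique⊆⇒length≤ (labels t) (vertexList n) u (All.lookup labels⊆))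
    n≤size : n ≤ length (labels t)
    n≤size = subst (_≤ length (labels t)) (vertexList-length n)
                   (unique⊆⇒length≤ (vertexList n) (labels t)
                                    (Descending⇒Unique (vertexList n) (vertexList-descending n)) (All.lookup ⊆labels))

module SizeIndependence where

  open FiniteSums
  open Splits
  open RootDecomposition
  open EnumerationCounts
  open VertexSets
  open import Data.Nat using (ℕ; zero; suc; _+_; _*_; _≤_; _<_; s≤s)
  import Data.Nat.Properties as ℕP
  open import Data.Nat.Induction using (<-rec)
  open import Data.List using (List; []; _∷_; map; length)
  open import Data.List.Membership.Propositional using (_∈_)
  open import Data.List.Relation.Unary.All as All using (All; _∷_)
  import Data.List.Relation.Unary.All.Properties as AllP
  open import Data.Empty using (⊥-elim)
  open import Data.Product using (_×_; _,_; proj₁; proj₂)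
  open import Relation.Nullary using (yes; no)
  open import Relation.Binary.PropositionalEquality using (_≡_; refl; sym; trans; cong; cong₂; subst)

  treeCount leafCount : ℕ → ℕ
  treeCount k = #trees  k (suc k) (vertexList k)
  leafCount k = #leaves k (suc k) (vertexList k)

  Admissible : ℕ → List ℕ → Set
  Admissible n S = Descending S × All (InRange n) S

  -- Counting trees on S depends only on the size of S, provided the
  -- height bound exceeds |S| (a tree on S has height < |S|).
  SizeIndependent : ℕ → Set
  SizeIndependent k = ∀ n h S → Admissible n S → length S ≡ k → k < h →
                      #trees n h S ≡ treeCount k × #leaves n h S ≡ leafCount k

  count-[] : ∀ w n h → count w n h [] ≡ 0
  count-[] w n h = ∑-zero (treesOfHeight< n h) _ (λ t _ → cong (_* w t) (noTree t))
    where
    noTree : ∀ t → 𝟙 (treeOn? [] t) ≡ 0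
    noTree t with treeOn? [] t
    ... | yes on = ⊥-elim (no-tree-on-[] t on)
    ... | no _   = refl

  admissible-splits : ∀ n rest {L R} → Admissible n rest → (L , R) ∈ splits rest → Admissible n L × Admissible n R
  admissible-splits n rest (d , inRange) p∈ =
    (proj₁ (splits-descending rest d p∈) , AllP.anti-mono (proj₁ (splits-⊆ rest p∈)) inRange) ,
    (proj₂ (splits-descending rest d p∈) , AllP.anti-mono (proj₂ (splits-⊆ rest p∈)) inRange)

  splits-sizes : ∀ (xs ys : List ℕ) → length xs ≡ length ys → ∀ (F : ℕ → ℕ → ℕ) →
    ∑ (splits xs) (λ p → F (length (proj₁ p)) (length (proj₂ p)))
    ≡ ∑ (splits ys) (λ p → F (length (proj₁ p)) (length (proj₂ p)))
  splits-sizes []       []       _   F = refl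
  splits-sizes (x ∷ xs) (y ∷ ys) |≡| F =
    trans (∑-++ (map (toLeft x) (splits xs)) _ (sizes F))
    (trans (cong₂ _+_ (trans (∑-map (toLeft x) (splits xs) (sizes F))
                       (trans (splits-sizes xs ys (ℕP.suc-injective |≡|) (λ a b → F (suc a) b))
                              (sym (∑-map (toLeft y) (splits ys) (sizes F)))))
                      (trans (∑-map (toRight x) (splits xs) (sizes F))
                       (trans (splits-sizes xs ys (ℕP.suc-injective |≡|) (λ a b → F a (suc b)))
                              (sym (∑-map (toRight y) (splits ys) (sizes F))))))
           (sym (∑-++ (map (toLeft y) (splits ys)) _ (sizes F))))
    where
    sizes : (ℕ → ℕ → ℕ) → List ℕ × List ℕ → ℕ
    sizes G p = G (length (proj₁ p)) (length (proj₂ p))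

  treeRec leafRec : List ℕ → ℕ
  treeRec rest = emptyIndicator rest + (treeCount (length rest)
    + ∑ (splits rest) (λ p → treeCount (length (proj₁ p)) * treeCount (length (proj₂ p))))
  leafRec rest = emptyIndicator rest + (leafCount (length rest)
    + ∑ (splits rest) (λ p → leafCount (length (proj₁ p)) * treeCount (length (proj₂ p))
                            + treeCount (length (proj₁ p)) * leafCount (length (proj₂ p))))

  recs-sizes : ∀ xs ys → length xs ≡ length ys → treeRec xs ≡ treeRec ys × leafRec xs ≡ leafRec ys
  recs-sizes xs ys |≡| =
    cong₂ _+_ (emptyIndicator-length xs ys |≡|)
              (cong₂ _+_ (cong treeCount |≡|) (splits-sizes xs ys |≡| (λ a b → treeCount a * treeCount b))) ,
    cong₂ _+_ (emptyIndicator-length xs ys |≡|)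
              (cong₂ _+_ (cong leafCount |≡|)
                         (splits-sizes xs ys |≡| (λ a b → leafCount a * treeCount b + treeCount a * leafCount b)))
    where
    emptyIndicator-length : ∀ (xs ys : List ℕ) → length xs ≡ length ys → emptyIndicator xs ≡ emptyIndicator ys
    emptyIndicator-length []      []      _ = refl
    emptyIndicator-length (_ ∷ _) (_ ∷ _) _ = refl

  count-via-sizes : ∀ n h m rest → (∀ i → i ≤ length rest → SizeIndependent i) →
                    Admissible n (m ∷ rest) → length rest < h →
                    #trees n (suc h) (m ∷ rest) ≡ treeRec rest × #leaves n (suc h) (m ∷ rest) ≡ leafRec rest
  count-via-sizes n h m rest IH ((rest<m , d) , (1≤m , m≤n) ∷ inRange) |rest|<h =
    trans (#trees-step n h m rest (rest<m , d) 1≤m m≤n)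
          (cong (emptyIndicator rest +_) (cong₂ _+_ (proj₁ onRest)
                (∑-cong (splits rest) (λ p p∈ → cong₂ _*_ (proj₁ (onLeft p p∈)) (proj₁ (onRight p p∈)))))) ,
    trans (#leaves-step n h m rest (rest<m , d) 1≤m m≤n)
          (cong (emptyIndicator rest +_) (cong₂ _+_ (proj₂ onRest)
                (∑-cong (splits rest) (λ p p∈ → cong₂ _+_ (cong₂ _*_ (proj₂ (onLeft p p∈)) (proj₁ (onRight p p∈)))
                                                          (cong₂ _*_ (proj₁ (onLeft p p∈)) (proj₂ (onRight p p∈)))))))
    where
    onSublist : ∀ X → Admissible n X → length X ≤ length rest →
                #trees n h X ≡ treeCount (length X) × #leaves n h X ≡ leafCount (length X)
    onSublist X adm |X|≤ = IH (length X) |X|≤ n h X adm refl (ℕP.≤-<-trans |X|≤ |rest|<h)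
    onRest = onSublist rest (d , inRange) ℕP.≤-refl
    onLeft : ∀ p → p ∈ splits rest → _
    onLeft p p∈ = onSublist (proj₁ p) (proj₁ (admissible-splits n rest (d , inRange) p∈)) (proj₁ (splits-length rest p∈))
    onRight : ∀ p → p ∈ splits rest → _
    onRight p p∈ = onSublist (proj₂ p) (proj₂ (admissible-splits n rest (d , inRange) p∈)) (proj₂ (splits-length rest p∈))

  vertexList-admissible : ∀ n → Admissible n (vertexList n)
  vertexList-admissible n = vertexList-descending n , All.tabulate (vertexList-∈⁻ n)

  -- Strong induction on k: for S = m ∷ rest both #trees n h S and the
  -- reference count on [k] follow recurrences that depend only on |rest|.
  size-independent : ∀ k → SizeIndependent k
  size-independent = <-rec SizeIndependent step
    where
    step : ∀ k → (∀ {i} → i < k → SizeIndependent i) → SizeIndependent k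
    step zero     _  n h []         _   _   _           = count-[] (λ _ → 1) n h , count-[] leaves n h
    step (suc k′) IH n (suc h′) (m ∷ rest) adm |S|≡ (s≤s k′<h′) =
      trans (proj₁ onS) (trans (proj₁ sameRecs) (sym (proj₁ onVertices))) ,
      trans (proj₂ onS) (trans (proj₂ sameRecs) (sym (proj₂ onVertices)))
      where
      |rest|≡k′ = ℕP.suc-injective |S|≡
      smaller : ∀ (xs : List ℕ) → length xs ≡ k′ → ∀ i → i ≤ length xs → SizeIndependent i
      smaller _ |xs|≡ i i≤ = IH (s≤s (subst (i ≤_) |xs|≡ i≤))
      onS = count-via-sizes n h′ m rest (smaller rest |rest|≡k′) adm (subst (_< h′) (sym |rest|≡k′) k′<h′)
      onVertices = count-via-sizes (suc k′) (suc k′) (suc k′) (vertexList k′) (smaller (vertexList k′) (vertexList-length k′))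
                                   (vertexList-admissible (suc k′)) (subst (_< suc k′) (sym (vertexList-length k′)) ℕP.≤-refl)
      sameRecs = recs-sizes rest (vertexList k′) (trans |rest|≡k′ (sym (vertexList-length k′)))

  -- The recurrences for the counts on [k+1]: the root is k+1 and the
  -- remaining labels [k] are distributed among the children.
  counts-rec : ∀ k → treeCount (suc k) ≡ treeRec (vertexList k) × leafCount (suc k) ≡ leafRec (vertexList k)
  counts-rec k = count-via-sizes (suc k) (suc k) (suc k) (vertexList k) (λ i _ → size-independent i)
                                 (vertexList-admissible (suc k)) (subst (_< suc k) (sym (vertexList-length k)) ℕP.≤-refl)

module GeneratingFunctions where

  open SeriesAlgebra using (_≐_; leibniz; ⊛-cong)
  open FiniteSums
  open Splits using (splits; toLeft; toRight)
  open RootDecomposition using (treeOn?; emptyIndicator)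
  open VertexSets
  open SizeIndependence
  open import Data.Nat as ℕ using (ℕ; zero; suc)
  import Data.Nat.Properties as ℕP
  open import Data.Integer using (+_; -_; _+_; _*_)
  import Data.Integer.Properties as ℤP
  open import Data.Integer.Tactic.RingSolver using (solve-∀)
  open import Data.List using (List; []; _∷_; map; length)
  open import Data.Product using (_,_; proj₁; proj₂)
  open import Relation.Binary.PropositionalEquality using (_≡_; refl; sym; trans; cong; cong₂)
  open Relation.Binary.PropositionalEquality.≡-Reasoning

  -- Summing f(|L|)·g(|R|) over the splits (L, R) of an n-element list gives
  -- the binomial convolution Σ_k C(n,k) f(k) g(n−k), i.e. coefficient n of
  -- the product of the EGFs of f and g.
  splits-convolution : ∀ (f g : ℕ → ℕ) xs →
    + ∑ (splits xs) (λ p → f (length (proj₁ p)) ℕ.* g (length (proj₂ p)))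
    ≡ (fromℕseq f ⊛ fromℕseq g) (length xs)
  splits-convolution f g []       = begin
    + (f 0 ℕ.* g 0 ℕ.+ 0)   ≡⟨ cong +_ (ℕP.+-identityʳ (f 0 ℕ.* g 0)) ⟩
    + (f 0 ℕ.* g 0)         ≡⟨ ℤP.pos-* (f 0) (g 0) ⟩
    + f 0 * + g 0           ≡⟨ cong (_* + g 0) (sym (ℤP.*-identityˡ (+ f 0))) ⟩
    + 1 * + f 0 * + g 0     ∎
  splits-convolution f g (x ∷ xs) = begin
    + ∑ (map (toLeft x) (splits xs) Data.List.++ map (toRight x) (splits xs)) h
      ≡⟨ cong +_ (∑-++ (map (toLeft x) (splits xs)) (map (toRight x) (splits xs)) h) ⟩
    + (∑ (map (toLeft x) (splits xs)) h ℕ.+ ∑ (map (toRight x) (splits xs)) h)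
      ≡⟨ ℤP.pos-+ (∑ (map (toLeft x) (splits xs)) h) (∑ (map (toRight x) (splits xs)) h) ⟩
    + ∑ (map (toLeft x) (splits xs)) h + + ∑ (map (toRight x) (splits xs)) h
      ≡⟨ cong₂ (λ a b → + a + + b) (∑-map (toLeft x) (splits xs) h) (∑-map (toRight x) (splits xs) h) ⟩
    + ∑ (splits xs) (λ p → f (suc (length (proj₁ p))) ℕ.* g (length (proj₂ p)))
      + + ∑ (splits xs) (λ p → f (length (proj₁ p)) ℕ.* g (suc (length (proj₂ p))))
      ≡⟨ cong₂ _+_ (splits-convolution (λ k → f (suc k)) g xs) (splits-convolution f (λ k → g (suc k)) xs) ⟩
    (deriv (fromℕseq f) ⊛ fromℕseq g) (length xs) + (fromℕseq f ⊛ deriv (fromℕseq g)) (length xs)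
      ≡⟨ sym (leibniz (fromℕseq f) (fromℕseq g) (length xs)) ⟩
    (fromℕseq f ⊛ fromℕseq g) (length (x ∷ xs)) ∎
    where
    h : List ℕ Data.Product.× List ℕ → ℕ
    h p = f (length (proj₁ p)) ℕ.* g (length (proj₂ p))

  labeled-indicator : ∀ n t → 𝟙 (isLabeled12Tree? n t) ≡ 𝟙 (treeOn? (vertexList n) t)
  labeled-indicator n t = 𝟙-cong (labeled⇒treeOn n t) (treeOn⇒labeled n t) (isLabeled12Tree? n t) (treeOn? (vertexList n) t)

  b≡treeCount : ∀ k → b (suc k) ≡ treeCount (suc k)
  b≡treeCount k = trans (length-filter (isLabeled12Tree? (suc k)) (treesOfHeight< (suc k) (suc (suc k))))
    (∑-cong (treesOfHeight< (suc k) (suc (suc k))) (λ t _ → cong (ℕ._* 1) (labeled-indicator (suc k) t)))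

  b0≡leafCount : ∀ k → b0 k ≡ leafCount k
  b0≡leafCount k = trans (sum-filter (isLabeled12Tree? k) leaves (treesOfHeight< k (suc k)))
    (∑-cong (treesOfHeight< k (suc k)) (λ t _ → cong (ℕ._* leaves t) (labeled-indicator k t)))

  -- T = B − 1 is the EGF of the tree counts (without the convention b₀ = 1),
  -- and B₀ the EGF of the leaf counts.
  T : EGF
  T = BS ⊕ scale (- (+ 1)) one

  T≐treeCount : T ≐ fromℕseq treeCount
  T≐treeCount zero    = refl
  T≐treeCount (suc k) = trans (ℤP.+-identityʳ (+ b (suc k))) (cong +_ (b≡treeCount k))

  B0S≐leafCount : B0S ≐ fromℕseq leafCount
  B0S≐leafCount k = cong +_ (b0≡leafCount k)

  one≐emptyIndicator : ∀ n → one n ≡ + emptyIndicator (vertexList n)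
  one≐emptyIndicator zero    = refl
  one≐emptyIndicator (suc n) = refl

  convolution : ∀ n (f g : ℕ → ℕ) {F G : EGF} → F ≐ fromℕseq f → G ≐ fromℕseq g →
    + ∑ (splits (vertexList n)) (λ p → f (length (proj₁ p)) ℕ.* g (length (proj₂ p))) ≡ (F ⊛ G) n
  convolution n f g F≐ G≐ =
    trans (splits-convolution f g (vertexList n))
          (trans (cong (fromℕseq f ⊛ fromℕseq g) (vertexList-length n)) (sym (⊛-cong F≐ G≐ n)))

  posSum₃ : ∀ a b c → + (a ℕ.+ (b ℕ.+ c)) ≡ + a + (+ b + + c)
  posSum₃ a b c = trans (ℤP.pos-+ a (b ℕ.+ c)) (cong (λ y → + a + y) (ℤP.pos-+ b c))

  T-ode : deriv T ≐ ((one ⊕ T) ⊕ (T ⊛ T))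
  T-ode n = begin
    T (suc n)
      ≡⟨ T≐treeCount (suc n) ⟩
    + treeCount (suc n)
      ≡⟨ cong +_ (proj₁ (counts-rec n)) ⟩
    + treeRec (vertexList n)
      ≡⟨ posSum₃ (emptyIndicator (vertexList n)) (treeCount (length (vertexList n))) (∑ (splits (vertexList n)) h) ⟩
    + emptyIndicator (vertexList n) + (+ treeCount (length (vertexList n)) + + ∑ (splits (vertexList n)) h)
      ≡⟨ cong₂ (λ a c → a + c) (sym (one≐emptyIndicator n))
               (cong₂ _+_ (trans (cong (λ k → + treeCount k) (vertexList-length n)) (sym (T≐treeCount n)))
                          (convolution n treeCount treeCount T≐treeCount T≐treeCount)) ⟩
    one n + (T n + (T ⊛ T) n)
      ≡⟨ sym (ℤP.+-assoc (one n) (T n) ((T ⊛ T) n)) ⟩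
    ((one ⊕ T) ⊕ (T ⊛ T)) n ∎
    where
    h : List ℕ Data.Product.× List ℕ → ℕ
    h p = treeCount (length (proj₁ p)) ℕ.* treeCount (length (proj₂ p))

  B0S-ode : deriv B0S ≐ (((B0S ⊛ T) ⊕ (T ⊛ B0S)) ⊕ (B0S ⊕ one))
  B0S-ode n = begin
    B0S (suc n)
      ≡⟨ B0S≐leafCount (suc n) ⟩
    + leafCount (suc n)
      ≡⟨ cong +_ (proj₂ (counts-rec n)) ⟩
    + leafRec (vertexList n)
      ≡⟨ posSum₃ (emptyIndicator (vertexList n)) (leafCount (length (vertexList n))) (∑ (splits (vertexList n)) (λ p → h₁ p ℕ.+ h₂ p)) ⟩
    + emptyIndicator (vertexList n) + (+ leafCount (length (vertexList n)) + + ∑ (splits (vertexList n)) (λ p → h₁ p ℕ.+ h₂ p))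
      ≡⟨ cong (λ x → + emptyIndicator (vertexList n) + (+ leafCount (length (vertexList n)) + x))
              (trans (cong +_ (∑-+ (splits (vertexList n)) h₁ h₂)) (ℤP.pos-+ (∑ (splits (vertexList n)) h₁) (∑ (splits (vertexList n)) h₂))) ⟩
    + emptyIndicator (vertexList n) + (+ leafCount (length (vertexList n))
      + (+ ∑ (splits (vertexList n)) h₁ + + ∑ (splits (vertexList n)) h₂))
      ≡⟨ cong₂ (λ a c → a + c) (sym (one≐emptyIndicator n))
               (cong₂ _+_ (trans (cong (λ k → + leafCount k) (vertexList-length n)) (sym (B0S≐leafCount n)))
                          (cong₂ _+_ (convolution n leafCount treeCount B0S≐leafCount T≐treeCount)
                                     (convolution n treeCount leafCount T≐treeCount B0S≐leafCount))) ⟩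
    one n + (B0S n + ((B0S ⊛ T) n + (T ⊛ B0S) n))
      ≡⟨ rearrange (one n) (B0S n) ((B0S ⊛ T) n) ((T ⊛ B0S) n) ⟩
    (((B0S ⊛ T) ⊕ (T ⊛ B0S)) ⊕ (B0S ⊕ one)) n ∎
    where
    h₁ h₂ : List ℕ Data.Product.× List ℕ → ℕ
    h₁ p = leafCount (length (proj₁ p)) ℕ.* treeCount (length (proj₂ p))
    h₂ p = treeCount (length (proj₁ p)) ℕ.* leafCount (length (proj₂ p))
    rearrange : ∀ e l x y → e + (l + (x + y)) ≡ (x + y) + (l + e)
    rearrange = solve-∀

open SeriesIdentities using (riccati-solution; linear-solution; symmetric-ode)
open GeneratingFunctions using (T; T-ode; B0S-ode)
open import Data.Integer using (+_; -_)
open import Data.Product using (_×_; _,_)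
open import Relation.Binary.PropositionalEquality using (_≡_; refl)

theorem3p1 : (∀ n → (B0S ⊛ denom) n ≡ numer n)
    × (∀ n → deriv B0S n ≡ (scale (+ 2) (B0S ⊛ (BS ⊕ scale (- (+ 1)) one)) ⊕ (B0S ⊕ one)) n)
theorem3p1 =
  linear-solution T B0S (riccati-solution T refl T-ode) refl B0S-ode ,
  symmetric-ode T B0S B0S-ode
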